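{- Let $r\geq 1$ and let $n_1,\ldots,n_r\geq 2$ be integers, and let $C_{n_k}$ denote the cycle on $n_k$ vertices for $1\leq k\leq r$. Let $\mu$ be the number of even numbers among $n_1,\ldots,n_r$. Then $$\mathrm{src}(C_{n_1}\square\cdots\square C_{n_r})\leq \begin{cases} \left\lceil\dfrac{n_1+\cdots+n_r-\mu}{2}\right\rceil, & 0\leq \mu\leq \left\lfloor\dfrac{r}{2}\right\rfloor,\\[2mm] \left\lceil\dfrac{n_1+\cdots+n_r-r+\mu}{2}\right\rceil, & \left\lfloor\dfrac{r}{2}\right\rfloor+1\leq \mu\leq r.\end{cases}$$
   Context: All graphs are finite, simple and connected; $C_n$ is the cycle on $n$ vertices, and $C_2$ (two vertices joined by an edge, as graphs are simple) is allowed. An edge-coloring $\zeta:E(\Gamma)\to\{1,\ldots,k\}$ (adjacent edges may share colors) is a strong rainbow $k$-coloring if every two distinct vertices $u,v$ are joined by a path of length $d(u,v)$ (the graph distance) whose edges have pairwise distinct colors. The strong rainbow connection number $\mathrm{src}(\Gamma)$ is the minimum $k$ for which a strong rainbow $k$-coloring of $\Gamma$ exists. The Cartesian product $\Gamma\square\Lambda$ has vertex set $V(\Gamma)\times V(\Lambda)$, with $(\gamma,\lambda)$ adjacent to $(\gamma',\lambda')$ iff either $\lambda=\lambda'$ and $\gamma\gamma'\in E(\Gamma)$, or $\gamma=\gamma'$ and $\lambda\lambda'\in E(\Lambda)$; it is associative and commutative up to isomorphism. -}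

module Defs where

open import Data.Nat using (ℕ; zero; suc; _+_; _∸_; _≤_; _<_; ⌈_/2⌉; ⌊_/2⌋; _≤ᵇ_)
open import Data.Bool using (if_then_else_)
open import Data.Nat.Divisibility using (_∣?_)
open import Data.Fin using (Fin; toℕ)
open import Data.Vec using (Vec; []; _∷_; count; sum)
open import Data.List using (List; []; _∷_; length)
open import Data.List.Relation.Unary.Unique.Propositional using (Unique)
open import Data.Product using (Σ; _×_; _,_; ∃-syntax)
open import Data.Sum using (_⊎_)
open import Relation.Binary.PropositionalEquality using (_≡_; _≢_)

record Graph : Set₁ where
  field
    V   : Set
    Adj : V → V → Set
open Graph public

-- The cycle C_n on vertices 0..n-1 : i ~ j iff j = i+1, i = j+1, or {i,j} = {0,n-1}.
-- For n = 2 this is the single edge C_2 (K_2); for n ≥ 2 there are no loops.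
Cycle : ℕ → Graph
Cycle n = record
  { V   = Fin n
  ; Adj = λ i j → (toℕ j ≡ suc (toℕ i)) ⊎ (toℕ i ≡ suc (toℕ j))
                  ⊎ ((toℕ i ≡ 0) × (toℕ j ≡ n ∸ 1))
                  ⊎ ((toℕ j ≡ 0) × (toℕ i ≡ n ∸ 1)) }

_□_ : Graph → Graph → Graph
Γ □ Λ = record
  { V   = V Γ × V Λ
  ; Adj = λ { (g , l) (g' , l') → ((l ≡ l') × Adj Γ g g') ⊎ ((g ≡ g') × Adj Λ l l') } }

cycleProduct : ∀ {r} → Vec ℕ (suc r) → Graph
cycleProduct (n ∷ [])     = Cycle n
cycleProduct (n ∷ m ∷ ns) = Cycle n □ cycleProduct (m ∷ ns)

data Walk (G : Graph) : V G → V G → Set where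
  here : ∀ {u} → Walk G u u
  step : ∀ {u w v} → Adj G u w → Walk G w v → Walk G u v

walkLength : ∀ {G u v} → Walk G u v → ℕ
walkLength here         = 0
walkLength (step _ w)   = suc (walkLength w)

-- An edge colouring with colours Fin k: a colour for every adjacent pair,
-- symmetric so that it is a colour of the (undirected) edge.
record EdgeColouring (G : Graph) (k : ℕ) : Set where
  field
    col  : ∀ {u v} → Adj G u v → Fin k
    symm : ∀ {u v} (e : Adj G u v) (e' : Adj G v u) → col e ≡ col e'
open EdgeColouring public

walkColours : ∀ {G k u v} → EdgeColouring G k → Walk G u v → List (Fin k)
walkColours c here       = []
walkColours c (step e w) = col c e ∷ walkColours c w

Geodesic : ∀ {G u v} → Walk G u v → Set
Geodesic {G} {u} {v} w = ∀ (w' : Walk G u v) → walkLength w ≤ walkLength w'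

IsStrongRainbow : ∀ {G k} → EdgeColouring G k → Set
IsStrongRainbow {G} c =
  ∀ (u v : V G) → u ≢ v →
    ∃[ w ] (Geodesic {G} {u} {v} w × Unique (walkColours c w))

-- src(G) ≤ b : the minimum k admitting a strong rainbow k-colouring is ≤ b,
-- i.e. some k ≤ b admits one.
src≤ : Graph → ℕ → Set
src≤ G b = ∃[ k ] (k ≤ b × Σ (EdgeColouring G k) IsStrongRainbow)

evenCount : ∀ {r} → Vec ℕ r → ℕ
evenCount = count (2 ∣?_)

srcBound : ∀ {r} → Vec ℕ r → ℕ
srcBound {r} ns =
  if evenCount ns ≤ᵇ ⌊ r /2⌋
  then ⌈ sum ns ∸ evenCount ns /2⌉
  else ⌈ sum ns ∸ r + evenCount ns /2⌉

module Submission where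

-- Plan of the proof.
-- (1) src is subadditive over □ for loopless graphs (the two kinds of edges get
--     disjoint palettes) and invariant under isomorphism, so factors may be regrouped.
-- (2) A cycle is coloured through a code of edge indices that is injective on every
--     arc covering at most half of the cycle; such arcs are geodesics.  This gives
--     src(C_{2b}) ≤ b and src(C_{2a+1}) ≤ a + 1.
-- (3) The key construction colours C_{2a+1} □ C_h with a + c colours from such a code
--     of C_h with c colours, the special colour of the odd cycle being shared with
--     the H-edges; so src(C_{2a+1} □ C_{2b}) ≤ a + b, src(C_{2a+1} □ C_{2b+1}) ≤ a + b + 1.
-- (4) Pairing every odd cycle with an even one while possible, and the remaining odd
--     cycles among themselves, gives src ≤ Σ⌊nᵢ/2⌋ + ⌈(#odd − #even)/2⌉ by induction
--     on the list of factors.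
-- (5) Elementary arithmetic shows that this is the bound of the theorem.

open import Defs
open import Data.Nat using (ℕ; zero; suc; _+_; _∸_; _≤_; _<_; z≤n; s≤s; _⊓_; ∣_-_∣; NonZero; ⌊_/2⌋; ⌈_/2⌉; _≤ᵇ_; _≟_)
open import Data.Nat.Properties
open import Data.Nat.DivMod
open import Data.Nat.Divisibility using (_∣_; _∣?_; divides)
open import Data.Fin using (Fin; toℕ; fromℕ<; _↑ˡ_; _↑ʳ_; splitAt)
open import Data.Fin.Properties using (any?; toℕ-injective; toℕ<n; toℕ-fromℕ<; ↑ˡ-injective; ↑ʳ-injective; splitAt-↑ˡ; splitAt-↑ʳ)
open import Data.List using (List; []; _∷_; _++_; map; reverse; applyUpTo; length)
open import Data.List.Properties using (unfold-reverse)
open import Data.List.Relation.Unary.Unique.Propositional using (Unique)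
import Data.List.Relation.Unary.Unique.Propositional.Properties as Unique
import Data.List.Relation.Unary.AllPairs as AllPairs
open import Data.List.Membership.Propositional using (_∈_)
open import Data.List.Membership.Propositional.Properties using (∈-map⁻; ∈-++⁻; ∈-++⁺ˡ; ∈-++⁺ʳ; ∈-applyUpTo⁻)
open import Data.List.Relation.Unary.Any using (here; there)
import Data.List.Relation.Unary.Any.Properties as Any
import Data.List.Relation.Unary.All as All
open import Data.Product using (Σ; _×_; _,_; proj₁; proj₂; ∃-syntax)
open import Data.Sum using (_⊎_; inj₁; inj₂; [_,_]′)
open import Data.Empty using (⊥; ⊥-elim)
open import Data.Unit using (⊤; tt)
open import Data.Bool using (Bool; true; false; not; if_then_else_; T)
open import Data.Bool.Properties using (T-≡; not-¬)
open import Function.Bundles using (Equivalence)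
open import Relation.Binary.PropositionalEquality
open import Relation.Nullary using (¬_; yes; no; does)
open import Data.Vec using (Vec; []; _∷_; toList; sum)
open import Data.Vec.Relation.Unary.All using (All)
open import Data.Vec.Relation.Unary.All.Properties using (toList⁺)
open import Data.Nat.Tactic.RingSolver using (solve-∀)

import Relation.Binary.PropositionalEquality.Properties as ≡
import Data.List.Relation.Binary.Permutation.Setoid as Perm
import Data.List.Relation.Binary.Permutation.Setoid.Properties as PermProps

Symmetric : Graph → Set
Symmetric G = ∀ {u v} → Adj G u v → Adj G v u

Loopless : Graph → Set
Loopless G = ∀ {u} → Adj G u u → ⊥

Labelling : Graph → Set → Set
Labelling G A = ∀ {i j} → Adj G i j → A

module _ {G : Graph} where

  edgeLabels : ∀ {A} → Labelling G A → ∀ {u v} → Walk G u v → List A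
  edgeLabels κ here       = []
  edgeLabels κ (step e w) = κ e ∷ edgeLabels κ w

  walkColours≡edgeLabels : ∀ {k} (c : EdgeColouring G k) {u v} (w : Walk G u v) →
    walkColours c w ≡ edgeLabels (col c) w
  walkColours≡edgeLabels c here       = refl
  walkColours≡edgeLabels c (step e w) = cong (_ ∷_) (walkColours≡edgeLabels c w)

  map-edgeLabels : ∀ {A B} (f : A → B) (κ : Labelling G A) {u v} (w : Walk G u v) →
    map f (edgeLabels κ w) ≡ edgeLabels (λ e → f (κ e)) w
  map-edgeLabels f κ here       = refl
  map-edgeLabels f κ (step e w) = cong (_ ∷_) (map-edgeLabels f κ w)

  edgeLabels-cong : ∀ {A} {κ κ' : Labelling G A} → (∀ {i j} (e : Adj G i j) → κ e ≡ κ' e) →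
    ∀ {u v} (w : Walk G u v) → edgeLabels κ w ≡ edgeLabels κ' w
  edgeLabels-cong eq here       = refl
  edgeLabels-cong eq (step e w) = cong₂ _∷_ (eq e) (edgeLabels-cong eq w)

  _++ʷ_ : ∀ {u v w} → Walk G u v → Walk G v w → Walk G u w
  here     ++ʷ q = q
  step e p ++ʷ q = step e (p ++ʷ q)

  length-++ʷ : ∀ {u v w} (p : Walk G u v) (q : Walk G v w) →
    walkLength (p ++ʷ q) ≡ walkLength p + walkLength q
  length-++ʷ here       q = refl
  length-++ʷ (step e p) q = cong suc (length-++ʷ p q)

  edgeLabels-++ʷ : ∀ {A} (κ : Labelling G A) {u v w} (p : Walk G u v) (q : Walk G v w) →
    edgeLabels κ (p ++ʷ q) ≡ edgeLabels κ p ++ edgeLabels κ q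
  edgeLabels-++ʷ κ here       q = refl
  edgeLabels-++ʷ κ (step e p) q = cong (_ ∷_) (edgeLabels-++ʷ κ p q)

  castʷ : ∀ {u u' v v'} → u ≡ u' → v ≡ v' → Walk G u v → Walk G u' v'
  castʷ refl refl w = w

  length-castʷ : ∀ {u u' v v'} (p : u ≡ u') (q : v ≡ v') (w : Walk G u v) →
    walkLength (castʷ p q w) ≡ walkLength w
  length-castʷ refl refl w = refl

  edgeLabels-castʷ : ∀ {A} (κ : Labelling G A) {u u' v v'} (p : u ≡ u') (q : v ≡ v') (w : Walk G u v) →
    edgeLabels κ (castʷ p q w) ≡ edgeLabels κ w
  edgeLabels-castʷ κ refl refl w = refl

  reverseʷ : Symmetric G → ∀ {u v} → Walk G u v → Walk G v u
  reverseʷ s here       = here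
  reverseʷ s (step e p) = reverseʷ s p ++ʷ step (s e) here

  length-reverseʷ : ∀ (s : Symmetric G) {u v} (w : Walk G u v) → walkLength (reverseʷ s w) ≡ walkLength w
  length-reverseʷ s here       = refl
  length-reverseʷ s (step e p) =
    trans (length-++ʷ (reverseʷ s p) _) (trans (+-comm (walkLength (reverseʷ s p)) 1) (cong suc (length-reverseʷ s p)))

  edgeLabels-reverseʷ : ∀ {A} (s : Symmetric G) (κ : Labelling G A) → (∀ {i j} (e : Adj G i j) → κ (s e) ≡ κ e) →
    ∀ {u v} (w : Walk G u v) → edgeLabels κ (reverseʷ s w) ≡ reverse (edgeLabels κ w)
  edgeLabels-reverseʷ s κ sym-κ here       = refl
  edgeLabels-reverseʷ s κ sym-κ (step e p) = begin
    edgeLabels κ (reverseʷ s p ++ʷ step (s e) here)  ≡⟨ edgeLabels-++ʷ κ (reverseʷ s p) _ ⟩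
    edgeLabels κ (reverseʷ s p) ++ κ (s e) ∷ []
      ≡⟨ cong₂ (λ xs x → xs ++ x ∷ []) (edgeLabels-reverseʷ s κ sym-κ p) (sym-κ e) ⟩
    reverse (edgeLabels κ p) ++ κ e ∷ []             ≡⟨ unfold-reverse (κ e) (edgeLabels κ p) ⟨
    reverse (κ e ∷ edgeLabels κ p)                   ∎
    where open ≡-Reasoning

Unique-reverse : ∀ {A : Set} (xs : List A) → Unique xs → Unique (reverse xs)
Unique-reverse {A} xs = PermProps.Unique-resp-↭ (≡.setoid A) (Perm.↭-sym (≡.setoid A) (PermProps.↭-reverse (≡.setoid A) xs))

applyUpTo-cong : ∀ {A : Set} {f g : ℕ → A} → (∀ s → f s ≡ g s) → ∀ t → applyUpTo f t ≡ applyUpTo g t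
applyUpTo-cong f≡g zero    = refl
applyUpTo-cong f≡g (suc t) = cong₂ _∷_ (f≡g 0) (applyUpTo-cong (λ s → f≡g (suc s)) t)

applyUpTo-+ : ∀ {A : Set} (f : ℕ → A) p q → applyUpTo f (p + q) ≡ applyUpTo f p ++ applyUpTo (λ s → f (p + s)) q
applyUpTo-+ f zero    q = refl
applyUpTo-+ f (suc p) q = cong (f 0 ∷_) (applyUpTo-+ (λ s → f (suc s)) p q)

RainbowGeodesic : ∀ {G k} → EdgeColouring G k → V G → V G → Set
RainbowGeodesic {G} c u v = ∃[ w ] (Geodesic {G} {u} {v} w × Unique (walkColours c w))

-- A colouring is strongly rainbow when every pair is joined by a rainbow geodesic
-- (the trivial walk serves for u = v); Src G b says src(G) ≤ b.
StronglyRainbow : ∀ {G k} → EdgeColouring G k → Set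
StronglyRainbow {G} c = ∀ (u v : V G) → RainbowGeodesic c u v

Src : Graph → ℕ → Set
Src G b = ∃[ k ] (k ≤ b × Σ (EdgeColouring G k) StronglyRainbow)

Src⇒src≤ : ∀ {G b} → Src G b → src≤ G b
Src⇒src≤ (k , k≤b , c , rainbow) = k , k≤b , c , λ u v _ → rainbow u v

Src-weaken : ∀ {G b b'} → Src G b → b ≤ b' → Src G b'
Src-weaken (k , k≤b , c) b≤b' = k , ≤-trans k≤b b≤b' , c

geodesic-of-length : ∀ {G u v} (w : Walk G u v) {t} → walkLength w ≡ t →
  (∀ (w' : Walk G u v) → t ≤ walkLength w') → Geodesic w
geodesic-of-length w refl lower = lower

rainbowGeodesic-sym : ∀ {G k} (s : Symmetric G) (c : EdgeColouring G k) {u v} →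
  RainbowGeodesic c v u → RainbowGeodesic c u v
rainbowGeodesic-sym {G} s c (w , geo , unique) =
  reverseʷ s w ,
  geodesic-of-length (reverseʷ s w) (length-reverseʷ s w)
    (λ w' → subst (walkLength w ≤_) (length-reverseʷ s w') (geo (reverseʷ s w'))) ,
  subst Unique (sym colours) (Unique-reverse _ unique)
  where
  colours : walkColours c (reverseʷ s w) ≡ reverse (walkColours c w)
  colours = begin
    walkColours c (reverseʷ s w)             ≡⟨ walkColours≡edgeLabels c (reverseʷ s w) ⟩
    edgeLabels (col c) (reverseʷ s w)        ≡⟨ edgeLabels-reverseʷ s (col c) (λ e → symm c (s e) e) w ⟩
    reverse (edgeLabels (col c) w)           ≡⟨ cong reverse (walkColours≡edgeLabels c w) ⟨
    reverse (walkColours c w)                ∎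
    where open ≡-Reasoning

module _ {Γ Λ : Graph} where

  liftˡ : ∀ {g g'} (l : V Λ) → Walk Γ g g' → Walk (Γ □ Λ) (g , l) (g' , l)
  liftˡ l here       = here
  liftˡ l (step e w) = step (inj₁ (refl , e)) (liftˡ l w)

  liftʳ : ∀ {l l'} (g : V Γ) → Walk Λ l l' → Walk (Γ □ Λ) (g , l) (g , l')
  liftʳ g here       = here
  liftʳ g (step e w) = step (inj₂ (refl , e)) (liftʳ g w)

  length-liftˡ : ∀ {g g'} l (w : Walk Γ g g') → walkLength (liftˡ l w) ≡ walkLength w
  length-liftˡ l here       = refl
  length-liftˡ l (step e w) = cong suc (length-liftˡ l w)

  length-liftʳ : ∀ {l l'} g (w : Walk Λ l l') → walkLength (liftʳ g w) ≡ walkLength w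
  length-liftʳ g here       = refl
  length-liftʳ g (step e w) = cong suc (length-liftʳ g w)

  edgeLabels-liftˡ : ∀ {A} (κ : Labelling (Γ □ Λ) A) {g g'} l (w : Walk Γ g g') →
    edgeLabels κ (liftˡ l w) ≡ edgeLabels (λ e → κ {_ , l} {_ , l} (inj₁ (refl , e))) w
  edgeLabels-liftˡ κ l here       = refl
  edgeLabels-liftˡ κ l (step e w) = cong (_ ∷_) (edgeLabels-liftˡ κ l w)

  edgeLabels-liftʳ : ∀ {A} (κ : Labelling (Γ □ Λ) A) {l l'} g (w : Walk Λ l l') →
    edgeLabels κ (liftʳ g w) ≡ edgeLabels (λ e → κ {g , _} {g , _} (inj₂ (refl , e))) w
  edgeLabels-liftʳ κ g here       = refl
  edgeLabels-liftʳ κ g (step e w) = cong (_ ∷_) (edgeLabels-liftʳ κ g w)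

  project : ∀ {x y} (W : Walk (Γ □ Λ) x y) →
    Σ (Walk Γ (proj₁ x) (proj₁ y)) λ a → Σ (Walk Λ (proj₂ x) (proj₂ y)) λ b →
      walkLength a + walkLength b ≡ walkLength W
  project here = here , here , refl
  project (step (inj₁ (p , e)) W) with project W
  ... | a , b , len = step e a , castʷ (sym p) refl b ,
        cong suc (trans (cong (walkLength a +_) (length-castʷ (sym p) refl b)) len)
  project (step (inj₂ (p , e)) W) with project W
  ... | a , b , len = castʷ (sym p) refl a , step e b ,
        trans (+-suc _ (walkLength b)) (cong suc (trans (cong (_+ walkLength b) (length-castʷ (sym p) refl a)) len))

  product-geodesic : ∀ {g g' l l'} (a : Walk Γ g g') (b : Walk Λ l l') → Geodesic a → Geodesic b →
    (W : Walk (Γ □ Λ) (g , l) (g' , l')) → walkLength W ≡ walkLength a + walkLength b → Geodesic W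
  product-geodesic a b geo-a geo-b W len = geodesic-of-length W len λ W' →
    let (a' , b' , len') = project W' in subst (walkLength a + walkLength b ≤_) len' (+-mono-≤ (geo-a a') (geo-b b'))

  □-symmetric : Symmetric Γ → Symmetric Λ → Symmetric (Γ □ Λ)
  □-symmetric sΓ sΛ (inj₁ (p , e)) = inj₁ (sym p , sΓ e)
  □-symmetric sΓ sΛ (inj₂ (p , e)) = inj₂ (sym p , sΛ e)

  □-loopless : Loopless Γ → Loopless Λ → Loopless (Γ □ Λ)
  □-loopless ℓΓ ℓΛ (inj₁ (_ , e)) = ℓΓ e
  □-loopless ℓΓ ℓΛ (inj₂ (_ , e)) = ℓΛ e

↑ˡ≢↑ʳ : ∀ {k₁ k₂} (x : Fin k₁) (y : Fin k₂) → x ↑ˡ k₂ ≢ k₁ ↑ʳ y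
↑ˡ≢↑ʳ {k₁} {k₂} x y eq with trans (sym (splitAt-↑ˡ k₁ x k₂)) (trans (cong (splitAt k₁) eq) (splitAt-↑ʳ k₁ k₂ y))
... | ()

-- Subadditivity, src(Γ □ Λ) ≤ src Γ + src Λ: colour the two kinds of edges with
-- disjoint palettes; a Γ-geodesic followed by a Λ-geodesic is then a rainbow geodesic.
module ProductColouring {Γ Λ : Graph} (ℓΓ : Loopless Γ) (ℓΛ : Loopless Λ) {k₁ k₂ : ℕ}
  (c₁ : EdgeColouring Γ k₁) (c₂ : EdgeColouring Λ k₂) where

  colour : Labelling (Γ □ Λ) (Fin (k₁ + k₂))
  colour (inj₁ (_ , e)) = col c₁ e ↑ˡ k₂
  colour (inj₂ (_ , e)) = k₁ ↑ʳ col c₂ e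

  -- The mixed cases are impossible: they would make an edge a loop.
  colour-symm : ∀ {u v} (e : Adj (Γ □ Λ) u v) (e' : Adj (Γ □ Λ) v u) → colour e ≡ colour e'
  colour-symm (inj₁ (_ , e)) (inj₁ (_ , e'))  = cong (_↑ˡ k₂) (symm c₁ e e')
  colour-symm (inj₁ (_ , e)) (inj₂ (p' , _))  = ⊥-elim (ℓΓ (subst (Adj Γ _) p' e))
  colour-symm (inj₂ (_ , e)) (inj₁ (p' , _))  = ⊥-elim (ℓΛ (subst (Adj Λ _) p' e))
  colour-symm (inj₂ (_ , e)) (inj₂ (_ , e'))  = cong (k₁ ↑ʳ_) (symm c₂ e e')

  c : EdgeColouring (Γ □ Λ) (k₁ + k₂)
  c = record { col = colour ; symm = colour-symm }

  rainbow : StronglyRainbow c₁ → StronglyRainbow c₂ → StronglyRainbow c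
  rainbow r₁ r₂ (g , l) (g' , l') with r₁ g g' | r₂ l l'
  ... | a , geo-a , unique-a | b , geo-b , unique-b =
    W , product-geodesic a b geo-a geo-b W length-W ,
    subst Unique (sym colours) (Unique.++⁺ (Unique.map⁺ (↑ˡ-injective k₂ _ _) unique-a)
                                           (Unique.map⁺ (↑ʳ-injective k₁ _ _) unique-b) disjoint)
    where
    W : Walk (Γ □ Λ) (g , l) (g' , l')
    W = liftˡ l a ++ʷ liftʳ g' b
    length-W : walkLength W ≡ walkLength a + walkLength b
    length-W = trans (length-++ʷ (liftˡ l a) (liftʳ g' b)) (cong₂ _+_ (length-liftˡ l a) (length-liftʳ g' b))
    colours : walkColours c W ≡ map (_↑ˡ k₂) (walkColours c₁ a) ++ map (k₁ ↑ʳ_) (walkColours c₂ b)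
    colours = begin
      walkColours c W                                             ≡⟨ walkColours≡edgeLabels c W ⟩
      edgeLabels colour W                                         ≡⟨ edgeLabels-++ʷ colour (liftˡ l a) (liftʳ g' b) ⟩
      edgeLabels colour (liftˡ l a) ++ edgeLabels colour (liftʳ g' b)
        ≡⟨ cong₂ _++_ (edgeLabels-liftˡ colour l a) (edgeLabels-liftʳ colour g' b) ⟩
      edgeLabels (λ e → col c₁ e ↑ˡ k₂) a ++ edgeLabels (λ e → k₁ ↑ʳ col c₂ e) b
        ≡⟨ cong₂ _++_ (sym (map-edgeLabels (_↑ˡ k₂) (col c₁) a)) (sym (map-edgeLabels (k₁ ↑ʳ_) (col c₂) b)) ⟩
      map (_↑ˡ k₂) (edgeLabels (col c₁) a) ++ map (k₁ ↑ʳ_) (edgeLabels (col c₂) b)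
        ≡⟨ cong₂ _++_ (cong (map _) (walkColours≡edgeLabels c₁ a)) (cong (map _) (walkColours≡edgeLabels c₂ b)) ⟨
      map (_↑ˡ k₂) (walkColours c₁ a) ++ map (k₁ ↑ʳ_) (walkColours c₂ b) ∎
      where open ≡-Reasoning
    disjoint : ∀ {x} → ¬ (x ∈ map (_↑ˡ k₂) (walkColours c₁ a) × x ∈ map (k₁ ↑ʳ_) (walkColours c₂ b))
    disjoint (p , q) with ∈-map⁻ (_↑ˡ k₂) p | ∈-map⁻ (k₁ ↑ʳ_) q
    ... | x , _ , refl | y , _ , eq = ↑ˡ≢↑ʳ x y eq

Src-□ : ∀ {Γ Λ b₁ b₂} → Loopless Γ → Loopless Λ → Src Γ b₁ → Src Λ b₂ → Src (Γ □ Λ) (b₁ + b₂)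
Src-□ ℓΓ ℓΛ (k₁ , k₁≤b₁ , c₁ , r₁) (k₂ , k₂≤b₂ , c₂ , r₂) =
  k₁ + k₂ , +-mono-≤ k₁≤b₁ k₂≤b₂ , c , rainbow r₁ r₂
  where open ProductColouring ℓΓ ℓΛ c₁ c₂

K₁ : Graph
K₁ = record { V = ⊤ ; Adj = λ _ _ → ⊥ }

Src-K₁ : Src K₁ 0
Src-K₁ = 0 , z≤n , record { col = λ () ; symm = λ () } , λ _ _ → here , (λ _ → z≤n) , AllPairs.[]

record _≅_ (G H : Graph) : Set where
  field
    to      : V G → V H
    from    : V H → V G
    from-to : ∀ x → from (to x) ≡ x
    to-from : ∀ y → to (from y) ≡ y
    to-adj   : ∀ {u v} → Adj G u v → Adj H (to u) (to v)
    from-adj : ∀ {u v} → Adj H u v → Adj G (from u) (from v)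

col-irrelevant : ∀ {H k} → Symmetric H → (c : EdgeColouring H k) → ∀ {a a' b b'} → a ≡ a' → b ≡ b' →
  (e : Adj H a b) (e' : Adj H a' b') → col c e ≡ col c e'
col-irrelevant s c refl refl e e' = trans (symm c e (s e')) (sym (symm c e' (s e')))

module Transport {G H : Graph} (iso : G ≅ H) (sH : Symmetric H) {k} (c : EdgeColouring H k) where
  open _≅_ iso

  c' : EdgeColouring G k
  c' = record { col = λ e → col c (to-adj e) ; symm = λ e e' → symm c (to-adj e) (to-adj e') }

  mapTo : ∀ {u v} → Walk G u v → Walk H (to u) (to v)
  mapTo here       = here
  mapTo (step e w) = step (to-adj e) (mapTo w)

  mapFrom : ∀ {u v} → Walk H u v → Walk G (from u) (from v)
  mapFrom here       = here
  mapFrom (step e w) = step (from-adj e) (mapFrom w)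

  length-mapTo : ∀ {u v} (w : Walk G u v) → walkLength (mapTo w) ≡ walkLength w
  length-mapTo here       = refl
  length-mapTo (step e w) = cong suc (length-mapTo w)

  length-mapFrom : ∀ {u v} (w : Walk H u v) → walkLength (mapFrom w) ≡ walkLength w
  length-mapFrom here       = refl
  length-mapFrom (step e w) = cong suc (length-mapFrom w)

  colours-mapFrom : ∀ {u v} (w : Walk H u v) → walkColours c' (mapFrom w) ≡ walkColours c w
  colours-mapFrom here       = refl
  colours-mapFrom (step e w) =
    cong₂ _∷_ (col-irrelevant sH c (to-from _) (to-from _) (to-adj (from-adj e)) e) (colours-mapFrom w)

  rainbow : StronglyRainbow c → StronglyRainbow c'
  rainbow r u v with r (to u) (to v)
  ... | W , geo , unique = W' ,
      geodesic-of-length W' length-W' (λ w' → subst (walkLength W ≤_) (length-mapTo w') (geo (mapTo w'))) ,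
      subst Unique (sym colours-W') unique
    where
    W' : Walk G u v
    W' = castʷ (from-to u) (from-to v) (mapFrom W)
    length-W' : walkLength W' ≡ walkLength W
    length-W' = trans (length-castʷ (from-to u) (from-to v) (mapFrom W)) (length-mapFrom W)
    colours-W' : walkColours c' W' ≡ walkColours c W
    colours-W' = begin
      walkColours c' W'                ≡⟨ walkColours≡edgeLabels c' W' ⟩
      edgeLabels (col c') W'           ≡⟨ edgeLabels-castʷ (col c') (from-to u) (from-to v) (mapFrom W) ⟩
      edgeLabels (col c') (mapFrom W)  ≡⟨ walkColours≡edgeLabels c' (mapFrom W) ⟨
      walkColours c' (mapFrom W)       ≡⟨ colours-mapFrom W ⟩
      walkColours c W                  ∎
      where open ≡-Reasoning

Src-≅ : ∀ {G H b} → G ≅ H → Symmetric H → Src H b → Src G b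
Src-≅ iso sH (k , k≤b , c , r) = k , k≤b , c' , rainbow r
  where open Transport iso sH c

≅-refl : ∀ {G} → G ≅ G
≅-refl = record { to = λ x → x ; from = λ x → x ; from-to = λ _ → refl ; to-from = λ _ → refl
                ; to-adj = λ e → e ; from-adj = λ e → e }

≅-trans : ∀ {G H K} → G ≅ H → H ≅ K → G ≅ K
≅-trans I J = record
  { to = λ x → J.to (I.to x) ; from = λ x → I.from (J.from x)
  ; from-to = λ x → trans (cong I.from (J.from-to (I.to x))) (I.from-to x)
  ; to-from = λ x → trans (cong J.to (I.to-from (J.from x))) (J.to-from x)
  ; to-adj = λ e → J.to-adj (I.to-adj e) ; from-adj = λ e → I.from-adj (J.from-adj e) }
  where module I = _≅_ I ; module J = _≅_ J

□-congʳ : ∀ {Γ Λ Λ'} → Λ ≅ Λ' → (Γ □ Λ) ≅ (Γ □ Λ')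
□-congʳ {Γ} {Λ} {Λ'} I = record
  { to = λ x → proj₁ x , I.to (proj₂ x) ; from = λ x → proj₁ x , I.from (proj₂ x)
  ; from-to = λ x → cong (proj₁ x ,_) (I.from-to (proj₂ x))
  ; to-from = λ x → cong (proj₁ x ,_) (I.to-from (proj₂ x))
  ; to-adj = to-adj ; from-adj = from-adj }
  where
  module I = _≅_ I
  to-adj : ∀ {u v} → Adj (Γ □ Λ) u v → Adj (Γ □ Λ') (proj₁ u , I.to (proj₂ u)) (proj₁ v , I.to (proj₂ v))
  to-adj (inj₁ (p , e)) = inj₁ (cong I.to p , e)
  to-adj (inj₂ (p , e)) = inj₂ (p , I.to-adj e)
  from-adj : ∀ {u v} → Adj (Γ □ Λ') u v → Adj (Γ □ Λ) (proj₁ u , I.from (proj₂ u)) (proj₁ v , I.from (proj₂ v))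
  from-adj (inj₁ (p , e)) = inj₁ (cong I.from p , e)
  from-adj (inj₂ (p , e)) = inj₂ (p , I.from-adj e)

□-assoc : ∀ {Γ Λ Θ} → (Γ □ (Λ □ Θ)) ≅ ((Γ □ Λ) □ Θ)
□-assoc {Γ} {Λ} {Θ} = record
  { to = λ x → (proj₁ x , proj₁ (proj₂ x)) , proj₂ (proj₂ x)
  ; from = λ x → proj₁ (proj₁ x) , (proj₂ (proj₁ x) , proj₂ x)
  ; from-to = λ _ → refl ; to-from = λ _ → refl ; to-adj = to-adj ; from-adj = from-adj }
  where
  to-adj : ∀ {u v} → Adj (Γ □ (Λ □ Θ)) u v →
    Adj ((Γ □ Λ) □ Θ) ((proj₁ u , proj₁ (proj₂ u)) , proj₂ (proj₂ u)) ((proj₁ v , proj₁ (proj₂ v)) , proj₂ (proj₂ v))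
  to-adj (inj₁ (p , e))             = inj₁ (cong proj₂ p , inj₁ (cong proj₁ p , e))
  to-adj (inj₂ (q , inj₁ (p , e)))  = inj₁ (p , inj₂ (q , e))
  to-adj (inj₂ (q , inj₂ (p , e)))  = inj₂ (cong₂ _,_ q p , e)
  from-adj : ∀ {u v} → Adj ((Γ □ Λ) □ Θ) u v →
    Adj (Γ □ (Λ □ Θ)) (proj₁ (proj₁ u) , (proj₂ (proj₁ u) , proj₂ u)) (proj₁ (proj₁ v) , (proj₂ (proj₁ v) , proj₂ v))
  from-adj (inj₁ (p , inj₁ (q , e))) = inj₁ (cong₂ _,_ q p , e)
  from-adj (inj₁ (p , inj₂ (q , e))) = inj₂ (q , inj₁ (p , e))
  from-adj (inj₂ (r , e))            = inj₂ (cong proj₁ r , inj₂ (cong proj₂ r , e))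

□-leftComm : ∀ {Γ Λ Θ} → (Γ □ (Λ □ Θ)) ≅ (Λ □ (Γ □ Θ))
□-leftComm {Γ} {Λ} {Θ} = record
  { to = exchange ; from = exchange ; from-to = λ _ → refl ; to-from = λ _ → refl
  ; to-adj = exchange-adj {Γ} {Λ} ; from-adj = exchange-adj {Λ} {Γ} }
  where
  exchange : ∀ {A B C : Set} → A × (B × C) → B × (A × C)
  exchange (x , (y , z)) = y , (x , z)
  exchange-adj : ∀ {Γ Λ} {u v} → Adj (Γ □ (Λ □ Θ)) u v → Adj (Λ □ (Γ □ Θ)) (exchange u) (exchange v)
  exchange-adj (inj₁ (p , e))            = inj₂ (cong proj₁ p , inj₁ (cong proj₂ p , e))
  exchange-adj (inj₂ (q , inj₁ (p , e))) = inj₁ (cong₂ _,_ q p , e)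
  exchange-adj (inj₂ (q , inj₂ (p , e))) = inj₂ (p , inj₂ (q , e))

□-unitʳ : ∀ {Γ} → Γ ≅ (Γ □ K₁)
□-unitʳ {Γ} = record { to = λ x → x , tt ; from = proj₁ ; from-to = λ _ → refl ; to-from = λ _ → refl
                     ; to-adj = λ e → inj₁ (refl , e) ; from-adj = from-adj }
  where
  from-adj : ∀ {u v} → Adj (Γ □ K₁) u v → Adj Γ (proj₁ u) (proj₁ v)
  from-adj (inj₁ (_ , e)) = e
  from-adj (inj₂ (_ , ()))

%-below-2n : ∀ b .{{_ : NonZero b}} y → y < b + b → (y < b × y % b ≡ y) ⊎ (b ≤ y × y % b ≡ y ∸ b)
%-below-2n b y y<2b with y <? b
... | yes y<b = inj₁ (y<b , m<n⇒m%n≡m y<b)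
... | no y≮b  = inj₂ (b≤y , trans (sym (m≤n⇒[n∸m]%m≡n%m b≤y)) (m<n⇒m%n≡m y∸b<b))
  where
  b≤y : b ≤ y
  b≤y = ≮⇒≥ y≮b
  y∸b<b : y ∸ b < b
  y∸b<b = +-cancelʳ-< b (y ∸ b) b (subst (_< b + b) (sym (m∸n+n≡m b≤y)) y<2b)

[m+d]%n≡[m%n+d]%n : ∀ n .{{_ : NonZero n}} m d → (m + d) % n ≡ ((m % n) + d) % n
[m+d]%n≡[m%n+d]%n n m d = trans (%-distribˡ-+ m d n)
  (sym (trans (%-distribˡ-+ (m % n) d n) (cong (λ x → (x + d % n) % n) (m%n%n≡m%n m n))))

%-shift-injective : ∀ b .{{_ : NonZero b}} x d → 0 < d → d < b → (x + d) % b ≢ x % b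
%-shift-injective b x d 0<d d<b eq with %-below-2n b (x % b + d) (+-mono-< (m%n<n x b) d<b)
... | inj₁ (_ , p) = <⇒≢ 0<d (sym (+-cancelˡ-≡ (x % b) d 0
        (trans (sym p) (trans (sym ([m+d]%n≡[m%n+d]%n b x d)) (trans eq (sym (+-identityʳ _)))))))
... | inj₂ (b≤ , p) = <⇒≢ d<b (+-cancelˡ-≡ (x % b) d b
        (trans (sym (m∸n+n≡m b≤)) (cong (_+ b) (trans (sym p) (trans (sym ([m+d]%n≡[m%n+d]%n b x d)) eq)))))

%≡0-below-2n : ∀ n .{{_ : NonZero n}} y → y < n + n → y % n ≡ 0 → y ≡ 0 ⊎ y ≡ n
%≡0-below-2n n y y<2n y%n≡0 with %-below-2n n y y<2n
... | inj₁ (_ , p)   = inj₁ (trans (sym p) y%n≡0)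
... | inj₂ (n≤y , p) = inj₂ (≤-antisym (m∸n≡0⇒m≤n (trans (sym p) y%n≡0)) n≤y)

window-gap : ∀ s s' z → s < s' → s' + z ≡ (s + z) + (s' ∸ s)
window-gap s s' z s<s' = begin
  s' + z                ≡⟨ cong (_+ z) (m+[n∸m]≡n (<⇒≤ s<s')) ⟨
  (s + (s' ∸ s)) + z    ≡⟨ +-assoc s (s' ∸ s) z ⟩
  s + ((s' ∸ s) + z)    ≡⟨ cong (s +_) (+-comm (s' ∸ s) z) ⟩
  s + (z + (s' ∸ s))    ≡⟨ +-assoc s z (s' ∸ s) ⟨
  (s + z) + (s' ∸ s)    ∎
  where open ≡-Reasoning

half-≤ : ∀ t b → t + t ≤ b + b → t ≤ b
half-≤ t b 2t≤2b with t ≤? b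
... | yes t≤b = t≤b
... | no t≰b  = ⊥-elim (<⇒≱ (+-mono-< (≰⇒> t≰b) (≰⇒> t≰b)) 2t≤2b)

half-≤-odd : ∀ t a → t + t ≤ suc (a + a) → t ≤ a
half-≤-odd t a 2t≤2a+1 with t ≤? a
... | yes t≤a = t≤a
... | no t≰a  = ⊥-elim (<⇒≱ (subst (_≤ t + t) (cong suc (+-suc a a)) (+-mono-≤ (≰⇒> t≰a) (≰⇒> t≰a))) 2t≤2a+1)

isEven : ℕ → Bool
isEven zero          = true
isEven (suc zero)    = false
isEven (suc (suc k)) = isEven k

isEven-suc : ∀ k → isEven (suc k) ≡ not (isEven k)
isEven-suc zero          = refl
isEven-suc (suc zero)    = refl
isEven-suc (suc (suc k)) = isEven-suc k

isEven-double : ∀ b → isEven (b + b) ≡ true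
isEven-double zero    = refl
isEven-double (suc b) = trans (cong (λ w → isEven (suc w)) (+-suc b b)) (isEven-double b)

not≢ : ∀ x → not x ≢ x
not≢ x eq = not-¬ refl (sym eq)

Cycle-symmetric : ∀ n → Symmetric (Cycle n)
Cycle-symmetric n (inj₁ p)                 = inj₂ (inj₁ p)
Cycle-symmetric n (inj₂ (inj₁ p))          = inj₁ p
Cycle-symmetric n (inj₂ (inj₂ (inj₁ p)))   = inj₂ (inj₂ (inj₂ p))
Cycle-symmetric n (inj₂ (inj₂ (inj₂ p)))   = inj₂ (inj₂ (inj₁ p))

Cycle-loopless : ∀ n → 2 ≤ n → Loopless (Cycle n)
Cycle-loopless (suc (suc m)) (s≤s (s≤s z≤n)) (inj₁ p)                       = 1+n≢n (sym p)
Cycle-loopless (suc (suc m)) (s≤s (s≤s z≤n)) (inj₂ (inj₁ p))                = 1+n≢n (sym p)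
Cycle-loopless (suc (suc m)) (s≤s (s≤s z≤n)) (inj₂ (inj₂ (inj₁ (p , q))))   = 0≢1+n (trans (sym p) q)
Cycle-loopless (suc (suc m)) (s≤s (s≤s z≤n)) (inj₂ (inj₂ (inj₂ (p , q))))   = 0≢1+n (trans (sym p) q)

∣n-1+n∣≡1 : ∀ x → ∣ x - suc x ∣ ≡ 1
∣n-1+n∣≡1 zero    = refl
∣n-1+n∣≡1 (suc x) = ∣n-1+n∣≡1 x

∸-lipschitz : ∀ n D D' → D' ≤ suc D → n ∸ D ≤ suc (n ∸ D')
∸-lipschitz zero D D' _ = subst (_≤ suc (0 ∸ D')) (sym (0∸n≡0 D)) z≤n
∸-lipschitz (suc n) zero zero _                 = n≤1+n _
∸-lipschitz (suc n) zero (suc zero) _           = ≤-refl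
∸-lipschitz (suc n) zero (suc (suc D')) (s≤s ())
∸-lipschitz (suc n) (suc D) zero _              = ≤-trans (m∸n≤m n D) (≤-trans (n≤1+n n) (n≤1+n (suc n)))
∸-lipschitz (suc n) (suc D) (suc D') (s≤s p)    = ∸-lipschitz n D D' p

-- The geometry of the cycle C_n, n = m + 2, with vertices read as residues mod n.
-- Edge i—i+1 gets index i and the closing edge (n-1)—0 gets index n - 1.
module CycleGeometry (m : ℕ) where

  n : ℕ
  n = suc (suc m)

  G : Graph
  G = Cycle n

  vertex : ℕ → Fin n
  vertex z = fromℕ< (m%n<n z n)

  toℕ-vertex : ∀ z → toℕ (vertex z) ≡ z % n
  toℕ-vertex z = toℕ-fromℕ< (m%n<n z n)

  vertex-toℕ : ∀ (i : Fin n) → vertex (toℕ i) ≡ i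
  vertex-toℕ i = toℕ-injective (trans (toℕ-vertex (toℕ i)) (m<n⇒m%n≡m (toℕ<n i)))

  edgeIndex : ∀ {i j} → Adj G i j → ℕ
  edgeIndex {i} (inj₁ _)          = toℕ i
  edgeIndex {j = j} (inj₂ (inj₁ _)) = toℕ j
  edgeIndex (inj₂ (inj₂ _))       = suc m

  private
    x≢2+x : ∀ x → x ≢ suc (suc x)
    x≢2+x zero    ()
    x≢2+x (suc x) p = x≢2+x x (suc-injective p)
    C₂ : ∀ {a} → a ≡ 1 → a ≡ suc m → m ≡ 0
    C₂ refl q = sym (suc-injective q)

  -- The two orientations of an edge carry the same index, except in C₂ where the
  -- single edge is also the closing edge (indices 0 and 1).
  edgeIndex-symmetric : (K : ℕ → ℕ) → (m ≡ 0 → K 0 ≡ K 1) →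
    ∀ {i j} (e : Adj G i j) (e' : Adj G j i) → K (edgeIndex e) ≡ K (edgeIndex e')
  edgeIndex-symmetric K K₂ (inj₁ p) (inj₁ q)                             = ⊥-elim (x≢2+x _ (trans q (cong suc p)))
  edgeIndex-symmetric K K₂ (inj₁ p) (inj₂ (inj₁ q))                      = refl
  edgeIndex-symmetric K K₂ (inj₁ p) (inj₂ (inj₂ (inj₁ (q , _))))         = ⊥-elim (0≢1+n (trans (sym q) p))
  edgeIndex-symmetric K K₂ (inj₁ p) (inj₂ (inj₂ (inj₂ (q , r)))) with C₂ (trans p (cong suc q)) r
  ... | refl = trans (cong K q) (K₂ refl)
  edgeIndex-symmetric K K₂ (inj₂ (inj₁ p)) (inj₁ q)                      = refl
  edgeIndex-symmetric K K₂ (inj₂ (inj₁ p)) (inj₂ (inj₁ q))               = ⊥-elim (x≢2+x _ (trans q (cong suc p)))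
  edgeIndex-symmetric K K₂ (inj₂ (inj₁ p)) (inj₂ (inj₂ (inj₁ (q , r)))) with C₂ (trans p (cong suc q)) r
  ... | refl = trans (cong K q) (K₂ refl)
  edgeIndex-symmetric K K₂ (inj₂ (inj₁ p)) (inj₂ (inj₂ (inj₂ (q , _))))  = ⊥-elim (0≢1+n (trans (sym q) p))
  edgeIndex-symmetric K K₂ (inj₂ (inj₂ (inj₁ (p , _)))) (inj₁ q)         = ⊥-elim (0≢1+n (trans (sym p) q))
  edgeIndex-symmetric K K₂ (inj₂ (inj₂ (inj₁ (p , r)))) (inj₂ (inj₁ q)) with C₂ (trans q (cong suc p)) r
  ... | refl = sym (trans (cong K p) (K₂ refl))
  edgeIndex-symmetric K K₂ (inj₂ (inj₂ (inj₁ (_ , r)))) (inj₂ (inj₂ (inj₁ (q , _)))) = ⊥-elim (0≢1+n (trans (sym q) r))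
  edgeIndex-symmetric K K₂ (inj₂ (inj₂ (inj₁ _))) (inj₂ (inj₂ (inj₂ _)))            = refl
  edgeIndex-symmetric K K₂ (inj₂ (inj₂ (inj₂ (p , r)))) (inj₁ q) with C₂ (trans q (cong suc p)) r
  ... | refl = sym (trans (cong K p) (K₂ refl))
  edgeIndex-symmetric K K₂ (inj₂ (inj₂ (inj₂ (p , _)))) (inj₂ (inj₁ q))  = ⊥-elim (0≢1+n (trans (sym p) q))
  edgeIndex-symmetric K K₂ (inj₂ (inj₂ (inj₂ _))) (inj₂ (inj₂ (inj₁ _)))            = refl
  edgeIndex-symmetric K K₂ (inj₂ (inj₂ (inj₂ (_ , r)))) (inj₂ (inj₂ (inj₂ (q , _)))) = ⊥-elim (0≢1+n (trans (sym q) r))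

  private
    1<n : 1 < n
    1<n = s≤s (s≤s z≤n)

  suc-% : ∀ z → suc z % n ≡ suc (z % n) % n
  suc-% z = trans (%-distribˡ-+ 1 z n) (cong (λ a → (a + z % n) % n) (m<n⇒m%n≡m 1<n))

  %-at-top : ∀ z → ¬ (suc (z % n) < n) → z % n ≡ suc m
  %-at-top z not-below = ≤-antisym (≤-pred (m%n<n z n)) (≤-pred (≮⇒≥ not-below))

  forward-edge : ∀ z → Adj G (vertex z) (vertex (suc z))
  forward-edge z with suc (z % n) <? n
  ... | yes below = inj₁ (trans (toℕ-vertex (suc z))
                       (trans (suc-% z) (trans (m<n⇒m%n≡m below) (cong suc (sym (toℕ-vertex z))))))
  ... | no top    = inj₂ (inj₂ (inj₂ (wraps , trans (toℕ-vertex z) (%-at-top z top))))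
    where
    wraps : toℕ (vertex (suc z)) ≡ 0
    wraps = trans (toℕ-vertex (suc z)) (trans (suc-% z) (trans (cong (λ a → suc a % n) (%-at-top z top)) (n%n≡0 n)))

  edgeIndex-forward : ∀ z → edgeIndex (forward-edge z) ≡ z % n
  edgeIndex-forward z with suc (z % n) <? n
  ... | yes _  = toℕ-vertex z
  ... | no top = sym (%-at-top z top)

  arc : ∀ z t → Walk G (vertex z) (vertex (t + z))
  arc z zero    = here
  arc z (suc t) = castʷ refl (cong vertex (+-suc t z)) (step (forward-edge z) (arc (suc z) t))

  length-arc : ∀ z t → walkLength (arc z t) ≡ t
  length-arc z zero    = refl
  length-arc z (suc t) =
    trans (length-castʷ refl (cong vertex (+-suc t z)) (step (forward-edge z) (arc (suc z) t))) (cong suc (length-arc (suc z) t))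

  edgeLabels-arc : ∀ {A} (κ : Labelling G A) (K : ℕ → A) → (∀ {i j} (e : Adj G i j) → κ e ≡ K (edgeIndex e)) →
    ∀ z t → edgeLabels κ (arc z t) ≡ applyUpTo (λ s → K ((s + z) % n)) t
  edgeLabels-arc κ K κ≡K z zero    = refl
  edgeLabels-arc κ K κ≡K z (suc t) =
    trans (edgeLabels-castʷ κ refl (cong vertex (+-suc t z)) (step (forward-edge z) (arc (suc z) t)))
      (cong₂ _∷_ (trans (κ≡K (forward-edge z)) (cong K (edgeIndex-forward z)))
        (trans (edgeLabels-arc κ K κ≡K (suc z) t)
               (applyUpTo-cong (λ s → cong (λ a → K (a % n)) (+-suc s z)) t)))

  distance : ℕ → ℕ → ℕ
  distance x y = ∣ x - y ∣ ⊓ (n ∸ ∣ x - y ∣)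

  distance-sym : ∀ x y → distance x y ≡ distance y x
  distance-sym x y = cong (λ d → d ⊓ (n ∸ d)) (∣-∣-comm x y)

  private
    ∣-∣-step : ∀ a b y → ∣ a - b ∣ ≡ 1 → ∣ a - y ∣ ≤ suc ∣ b - y ∣
    ∣-∣-step a b y p = subst (λ q → ∣ a - y ∣ ≤ q + ∣ b - y ∣) p (∣-∣-triangle a b y)

    distance-unit-step : ∀ a b y → ∣ a - b ∣ ≡ 1 → distance a y ≤ suc (distance b y)
    distance-unit-step a b y p = ⊓-mono-≤ (∣-∣-step a b y p)
      (∸-lipschitz n ∣ a - y ∣ ∣ b - y ∣ (∣-∣-step b a y (trans (∣-∣-comm b a) p)))

    distance-from-0 : ∀ y → y ≤ suc m → distance 0 y ≡ y ⊓ suc (suc m ∸ y)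
    distance-from-0 y y≤ = cong (y ⊓_) (+-∸-assoc 1 y≤)

    distance-from-top : ∀ y → y ≤ suc m → distance (suc m) y ≡ (suc m ∸ y) ⊓ suc y
    distance-from-top y y≤ = trans (cong (λ d → d ⊓ (n ∸ d)) (m≤n⇒∣n-m∣≡n∸m y≤))
      (cong ((suc m ∸ y) ⊓_) (trans (+-∸-assoc 1 (m∸n≤m (suc m) y)) (cong suc (m∸[m∸n]≡n y≤))))

  distance-step : ∀ {i k} → Adj G i k → ∀ y → y ≤ suc m → distance (toℕ i) y ≤ suc (distance (toℕ k) y)
  distance-step {i} {k} (inj₁ p) y _ =
    distance-unit-step (toℕ i) (toℕ k) y (trans (cong (λ q → ∣ toℕ i - q ∣) p) (∣n-1+n∣≡1 (toℕ i)))
  distance-step {i} {k} (inj₂ (inj₁ p)) y _ = distance-unit-step (toℕ i) (toℕ k) y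
    (trans (cong (λ q → ∣ q - toℕ k ∣) p) (trans (∣-∣-comm (suc (toℕ k)) (toℕ k)) (∣n-1+n∣≡1 (toℕ k))))
  distance-step {i} {k} (inj₂ (inj₂ (inj₁ (p , q)))) y y≤ rewrite p | q | distance-from-0 y y≤ | distance-from-top y y≤ =
    subst (λ r → y ⊓ suc (suc m ∸ y) ≤ suc r) (⊓-comm (suc y) (suc m ∸ y))
      (⊓-mono-≤ (≤-trans (n≤1+n y) (n≤1+n (suc y))) ≤-refl)
  distance-step {i} {k} (inj₂ (inj₂ (inj₂ (p , q)))) y y≤ rewrite p | q | distance-from-0 y y≤ | distance-from-top y y≤ =
    subst (λ r → (suc m ∸ y) ⊓ suc y ≤ suc r) (⊓-comm (suc (suc m ∸ y)) y)
      (⊓-mono-≤ (≤-trans (n≤1+n (suc m ∸ y)) (n≤1+n (suc (suc m ∸ y)))) ≤-refl)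

  distance≤length : ∀ {i j} (w : Walk G i j) → distance (toℕ i) (toℕ j) ≤ walkLength w
  distance≤length {i} here = subst (λ d → d ⊓ (n ∸ d) ≤ 0) (sym (∣n-n∣≡0 (toℕ i))) z≤n
  distance≤length {i} {j} (step e w) = ≤-trans (distance-step e (toℕ j) (≤-pred (toℕ<n j))) (s≤s (distance≤length w))

  arc-geodesic : ∀ {i j} z t (p : vertex z ≡ i) (q : vertex (t + z) ≡ j) → t ≤ distance (toℕ i) (toℕ j) →
    Geodesic (castʷ p q (arc z t))
  arc-geodesic z t p q t≤d = geodesic-of-length (castʷ p q (arc z t))
    (trans (length-castʷ p q (arc z t)) (length-arc z t)) (λ w' → ≤-trans t≤d (distance≤length w'))

  ShortArc : Fin n → Fin n → Set
  ShortArc i j = Σ ℕ λ z → Σ ℕ λ t → (t + t ≤ n) × (t ≤ distance (toℕ i) (toℕ j)) ×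
                   ((vertex z ≡ i × vertex (t + z) ≡ j) ⊎ (vertex z ≡ j × vertex (t + z) ≡ i))

  private
    shortArc-≤ : ∀ (i j : Fin n) → toℕ i ≤ toℕ j → ShortArc i j
    shortArc-≤ i j i≤j with (toℕ j ∸ toℕ i) + (toℕ j ∸ toℕ i) ≤? n
    ... | yes short = toℕ i , D , short , subst (D ≤_) (sym distance-D) (⊓-glb ≤-refl D≤n∸D) ,
                      inj₁ (vertex-toℕ i , trans (cong vertex (m∸n+n≡m i≤j)) (vertex-toℕ j))
      where
      D : ℕ
      D = toℕ j ∸ toℕ i
      distance-D : distance (toℕ i) (toℕ j) ≡ D ⊓ (n ∸ D)
      distance-D = cong (λ d → d ⊓ (n ∸ d)) (m≤n⇒∣m-n∣≡n∸m i≤j)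
      D≤n∸D : D ≤ n ∸ D
      D≤n∸D = subst (_≤ n ∸ D) (m+n∸n≡m D D) (∸-monoˡ-≤ D short)
    ... | no long = toℕ j , u , u+u≤n , subst (u ≤_) (sym distance-D) (⊓-glb (<⇒≤ u<D) ≤-refl) , inj₂ (vertex-toℕ j , ends)
      where
      D : ℕ
      D = toℕ j ∸ toℕ i
      u : ℕ
      u = n ∸ D
      distance-D : distance (toℕ i) (toℕ j) ≡ D ⊓ (n ∸ D)
      distance-D = cong (λ d → d ⊓ (n ∸ d)) (m≤n⇒∣m-n∣≡n∸m i≤j)
      u+D≡n : u + D ≡ n
      u+D≡n = m∸n+n≡m (≤-trans (m∸n≤m (toℕ j) (toℕ i)) (<⇒≤ (toℕ<n j)))
      u<D : u < D
      u<D = ≰⇒> λ D≤u → long (subst (D + D ≤_) u+D≡n (+-monoˡ-≤ D D≤u))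
      u+u≤n : u + u ≤ n
      u+u≤n = subst (u + u ≤_) u+D≡n (+-monoʳ-≤ u (<⇒≤ u<D))
      ends : vertex (u + toℕ j) ≡ i
      ends = toℕ-injective (trans (toℕ-vertex (u + toℕ j)) (trans (cong (_% n) u+j≡i+n)
               (trans ([m+n]%n≡m%n (toℕ i) n) (m<n⇒m%n≡m (toℕ<n i)))))
        where
        open ≡-Reasoning
        u+j≡i+n : u + toℕ j ≡ toℕ i + n
        u+j≡i+n = begin
          u + toℕ j          ≡⟨ cong (u +_) (m∸n+n≡m i≤j) ⟨
          u + (D + toℕ i)    ≡⟨ +-assoc u D (toℕ i) ⟨
          (u + D) + toℕ i    ≡⟨ cong (_+ toℕ i) u+D≡n ⟩
          n + toℕ i          ≡⟨ +-comm n (toℕ i) ⟩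
          toℕ i + n          ∎

  shortArc : ∀ (i j : Fin n) → ShortArc i j
  shortArc i j with ≤-total (toℕ i) (toℕ j)
  ... | inj₁ i≤j = shortArc-≤ i j i≤j
  ... | inj₂ j≤i with shortArc-≤ j i j≤i
  ...   | z , t , short , t≤d , inj₁ ends = z , t , short , subst (t ≤_) (distance-sym (toℕ j) (toℕ i)) t≤d , inj₂ ends
  ...   | z , t , short , t≤d , inj₂ ends = z , t , short , subst (t ≤_) (distance-sym (toℕ j) (toℕ i)) t≤d , inj₁ ends

  WindowInjective : (ℕ → ℕ) → Set
  WindowInjective K = ∀ z t → t + t ≤ n → ∀ {s s'} → s < s' → s' < t → K ((s + z) % n) ≢ K ((s' + z) % n)

  record WindowCode (k : ℕ) : Set where
    field
      code        : ℕ → ℕ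
      code<k      : ∀ x → code x < k
      code-C₂     : m ≡ 0 → code 0 ≡ code 1
      code-window : WindowInjective code

  -- Such a code gives a strong rainbow k-colouring of C_n: short arcs are rainbow geodesics.
  module CodeColouring {k} (W : WindowCode k) where
    open WindowCode W

    c : EdgeColouring G k
    c = record
      { col  = λ e → fromℕ< (code<k (edgeIndex e))
      ; symm = λ e e' → toℕ-injective (trans (toℕ-fromℕ< (code<k (edgeIndex e)))
                          (trans (edgeIndex-symmetric code code-C₂ e e') (sym (toℕ-fromℕ< (code<k (edgeIndex e')))))) }

    arc-rainbowGeodesic : ∀ {u v} z t → t + t ≤ n → t ≤ distance (toℕ u) (toℕ v) →
      (p : vertex z ≡ u) (q : vertex (t + z) ≡ v) → RainbowGeodesic c u v
    arc-rainbowGeodesic z t short t≤d p q =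
      castʷ p q (arc z t) , arc-geodesic z t p q t≤d ,
      Unique.map⁻ (subst Unique (sym codes) (Unique.applyUpTo⁺₁ _ t (code-window z t short)))
      where
      open ≡-Reasoning
      codes : map toℕ (walkColours c (castʷ p q (arc z t))) ≡ applyUpTo (λ s → code ((s + z) % n)) t
      codes = begin
        map toℕ (walkColours c (castʷ p q (arc z t)))     ≡⟨ cong (map toℕ) (walkColours≡edgeLabels c _) ⟩
        map toℕ (edgeLabels (col c) (castʷ p q (arc z t))) ≡⟨ cong (map toℕ) (edgeLabels-castʷ (col c) p q (arc z t)) ⟩
        map toℕ (edgeLabels (col c) (arc z t))             ≡⟨ map-edgeLabels toℕ (col c) (arc z t) ⟩
        edgeLabels (λ e → toℕ (col c e)) (arc z t)
          ≡⟨ edgeLabels-arc _ code (λ e → toℕ-fromℕ< (code<k (edgeIndex e))) z t ⟩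
        applyUpTo (λ s → code ((s + z) % n)) t             ∎

    rainbow : StronglyRainbow c
    rainbow i j with shortArc i j
    ... | z , t , short , t≤d , inj₁ (p , q) = arc-rainbowGeodesic z t short t≤d p q
    ... | z , t , short , t≤d , inj₂ (p , q) = rainbowGeodesic-sym (Cycle-symmetric n) c
           (arc-rainbowGeodesic z t short (subst (t ≤_) (distance-sym (toℕ i) (toℕ j)) t≤d) p q)

  Src-cycle : ∀ {k} → WindowCode k → Src G k
  Src-cycle {k} W = k , ≤-refl , c , rainbow
    where open CodeColouring W

  -- The property of a code K needed for the odd × C_n construction below: along
  -- every short arc, either the parity of the vertex index changes at some step,
  -- or K avoids the value σ.
  FlipOrAvoid : (ℕ → ℕ) → ℕ → Set
  FlipOrAvoid K σ = ∀ z t → t + t ≤ n →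
    (Σ ℕ λ s → s < t × isEven ((s + z) % n) ≢ isEven ((suc s + z) % n)) ⊎ (∀ s → s < t → K ((s + z) % n) ≢ σ)

  parity-flips : ∀ z → suc (z % n) < n → isEven ((0 + z) % n) ≢ isEven ((1 + z) % n)
  parity-flips z below eq = not≢ (isEven (z % n)) (begin
    not (isEven (z % n))     ≡⟨ isEven-suc (z % n) ⟨
    isEven (suc (z % n))     ≡⟨ cong isEven (trans (suc-% z) (m<n⇒m%n≡m below)) ⟨
    isEven ((1 + z) % n)     ≡⟨ eq ⟨
    isEven (z % n)           ∎)
    where open ≡-Reasoning

  wraps-to-0 : ∀ z → ¬ (suc (z % n) < n) → (1 + z) % n ≡ 0
  wraps-to-0 z top = trans (suc-% z) (trans (cong (λ w → suc w % n) (%-at-top z top)) (n%n≡0 n))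

-- C_{2b} is coloured by edge index mod b: an arc of at most b edges is rainbow.
-- Parity changes along every edge of an even cycle.
module EvenCycle (m b' : ℕ) (n≡2b : suc (suc m) ≡ suc b' + suc b') where
  open CycleGeometry m

  b : ℕ
  b = suc b'

  private
    C₂ : m ≡ 0 → 0 % b ≡ 1 % b
    C₂ refl = one b' n≡2b
      where
      one : ∀ c → 2 ≡ suc c + suc c → 0 % suc c ≡ 1 % suc c
      one zero    _ = refl
      one (suc c) e = ⊥-elim (0≢1+n (trans (suc-injective (suc-injective e)) (+-suc c (suc c))))

    b∣n : b ∣ n
    b∣n = divides 2 (trans n≡2b (cong (b +_) (sym (+-identityʳ b))))

    window : WindowInjective (_% b)
    window z t short {s} {s'} s<s' s'<t eq = %-shift-injective b (s + z) (s' ∸ s) (m<n⇒0<n∸m s<s') gap<b (begin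
      ((s + z) + (s' ∸ s)) % b   ≡⟨ cong (_% b) (window-gap s s' z s<s') ⟨
      (s' + z) % b               ≡⟨ m∣n⇒o%n%m≡o%m b n (s' + z) b∣n ⟨
      (s' + z) % n % b           ≡⟨ eq ⟨
      (s + z) % n % b            ≡⟨ m∣n⇒o%n%m≡o%m b n (s + z) b∣n ⟩
      (s + z) % b                ∎)
      where
      open ≡-Reasoning
      gap<b : s' ∸ s < b
      gap<b = ≤-<-trans (m∸n≤m s' s) (<-≤-trans s'<t (half-≤ t b (subst (t + t ≤_) n≡2b short)))

  windowCode : WindowCode b
  windowCode = record { code = _% b ; code<k = λ x → m%n<n x b ; code-C₂ = C₂ ; code-window = window }

  flipOrAvoid : FlipOrAvoid (_% b) 0
  flipOrAvoid z zero    _ = inj₂ (λ s ())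
  flipOrAvoid z (suc t) _ = inj₁ (0 , s≤s z≤n , flips)
    where
    odd-top : isEven (suc m) ≡ false
    odd-top = trans (isEven-suc m) (cong not (trans (cong isEven n≡2b) (isEven-double b)))
    flips : isEven ((0 + z) % n) ≢ isEven ((1 + z) % n)
    flips with suc (z % n) <? n
    ... | yes below = parity-flips z below
    ... | no top    = λ eq → not≢ true (begin
      not true                   ≡⟨ odd-top ⟨
      isEven (suc m)             ≡⟨ cong isEven (%-at-top z top) ⟨
      isEven (z % n)             ≡⟨ eq ⟩
      isEven ((1 + z) % n)       ≡⟨ cong isEven (wraps-to-0 z top) ⟩
      true                       ∎)
      where open ≡-Reasoning

-- C_{2a+1}: edge 0 gets a special colour S ≥ a and the edges 1, …, 2a get the
-- colours 0, …, a-1 twice around.  Any arc of at most a edges is then rainbow.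
module OddCycle (a' : ℕ) where
  open CycleGeometry (a' + suc a') using (n; WindowInjective; WindowCode; FlipOrAvoid; suc-%; %-at-top; parity-flips; wraps-to-0)

  a : ℕ
  a = suc a'

  oddCode : ℕ → ℕ → ℕ
  oddCode S zero    = S
  oddCode S (suc r) = r % a

  oddCode<a : ∀ S r → oddCode S (suc r) < a
  oddCode<a S r = m%n<n r a

  oddCode≢S : ∀ S → a ≤ S → ∀ r → oddCode S (suc r) ≢ S
  oddCode≢S S a≤S r = <⇒≢ (<-≤-trans (oddCode<a S r) a≤S)

  private
    d<n : ∀ {d} → d < a → d < n
    d<n d<a = <-trans d<a (s≤s (m≤m+n a a))

    -- Edges x'+1 and y'+1 with y'+1 ≡ x'+1+d - n: then x' = y' + (a + 1 - d) and 0 < a + 1 - d < a.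
    wrapped : ∀ x' y' d → x' < a + a → 0 < d → d < a → y' + n ≡ x' + d → x' % a ≢ y' % a
    wrapped x' y' d x'<2a 0<d d<a y'+n≡x'+d eq = %-shift-injective a y' d' 0<d' d'<a (trans (sym x'%a) eq)
      where
      2≤d : 2 ≤ d
      2≤d with d <? 2
      ... | no d≮2 = ≮⇒≥ d≮2
      ... | yes d<2 = ⊥-elim (<⇒≢ (≤-<-trans (+-monoʳ-≤ x' (≤-pred d<2))
                       (subst (_< y' + n) (+-comm 1 x') (<-≤-trans (s≤s x'<2a) (m≤n+m n y')))) (sym y'+n≡x'+d))
      d' : ℕ
      d' = suc a ∸ d
      d'+d : d' + d ≡ suc a
      d'+d = m∸n+n≡m (≤-trans (<⇒≤ d<a) (n≤1+n a))
      0<d' : 0 < d'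
      0<d' = m<n⇒0<n∸m (≤-trans d<a (n≤1+n a))
      d'<a : d' < a
      d'<a = ≤-pred (subst (suc (suc d') ≤_) d'+d (subst (_≤ d' + d) (+-comm d' 2) (+-monoʳ-≤ d' 2≤d)))
      x'≡ : x' ≡ (y' + d') + a
      x'≡ = +-cancelʳ-≡ d x' ((y' + d') + a)
              (trans (sym y'+n≡x'+d) (trans (cong (λ w → y' + (w + a)) (sym d'+d)) (regroup y' d' d a)))
        where
        regroup : ∀ y d' d a → y + ((d' + d) + a) ≡ ((y + d') + a) + d
        regroup = solve-∀
      x'%a : x' % a ≡ (y' + d') % a
      x'%a = trans (cong (_% a) x'≡) ([m+n]%n≡m%n (y' + d') a)

    apart : ∀ S → a ≤ S → ∀ d → 0 < d → d < a → ∀ x → x < n → ∀ y → y ≡ (x + d) % n → oddCode S x ≢ oddCode S y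
    apart S a≤S (suc d'') 0<d d<a zero _ y y≡ eq =
      oddCode≢S S a≤S d'' (sym (trans eq (cong (oddCode S) (trans y≡ (m<n⇒m%n≡m (d<n d<a))))))
    apart S a≤S d 0<d d<a (suc x') x<n y y≡ eq with %-below-2n n (suc x' + d) (+-mono-< x<n (d<n d<a))
    ... | inj₁ (_ , p) = %-shift-injective a x' d 0<d d<a (sym (trans eq (cong (oddCode S) (trans y≡ p))))
    ... | inj₂ (n≤ , p) = wrap y (trans y≡ p) eq
      where
      wrap : ∀ y → y ≡ suc x' + d ∸ n → oddCode S (suc x') ≢ oddCode S y
      wrap zero     _   eq' = oddCode≢S S a≤S x' eq'
      wrap (suc y') y≡' eq' = wrapped x' y' d (≤-pred x<n) 0<d d<a
        (suc-injective (trans (cong (_+ n) y≡') (m∸n+n≡m n≤))) eq'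

  oddCode-apart : ∀ S → a ≤ S → ∀ q d → 0 < d → d < a → oddCode S (q % n) ≢ oddCode S ((q + d) % n)
  oddCode-apart S a≤S q d 0<d d<a = apart S a≤S d 0<d d<a (q % n) (m%n<n q n) ((q + d) % n) ([m+d]%n≡[m%n+d]%n n q d)

  oddCode-window : ∀ S → a ≤ S → WindowInjective (λ x → oddCode S (x % n))
  oddCode-window S a≤S z t short {s} {s'} s<s' s'<t eq =
    oddCode-apart S a≤S (s + z) (s' ∸ s) (m<n⇒0<n∸m s<s') gap<a (begin
      oddCode S ((s + z) % n)                  ≡⟨ cong (oddCode S) (m%n%n≡m%n (s + z) n) ⟨
      oddCode S ((s + z) % n % n)              ≡⟨ eq ⟩
      oddCode S ((s' + z) % n % n)             ≡⟨ cong (oddCode S) (m%n%n≡m%n (s' + z) n) ⟩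
      oddCode S ((s' + z) % n)                 ≡⟨ cong (λ w → oddCode S (w % n)) (window-gap s s' z s<s') ⟩
      oddCode S (((s + z) + (s' ∸ s)) % n)     ∎)
    where
    open ≡-Reasoning
    gap<a : s' ∸ s < a
    gap<a = ≤-<-trans (m∸n≤m s' s) (<-≤-trans s'<t (half-≤-odd t a short))

  special-edge-once : ∀ z s s' → s < a → s' < a → (s + z) % n ≡ 0 → (s' + (z + suc a)) % n ≡ 0 → ⊥
  special-edge-once z s s' s<a s'<a first second
    with %≡0-below-2n n (z % n + s) (+-mono-< (m%n<n z n) (d<n s<a))
           (trans (sym ([m+d]%n≡[m%n+d]%n n z s)) (trans (cong (_% n) (+-comm z s)) first))
       | %≡0-below-2n n (z % n + (s' + suc a)) (+-mono-< (m%n<n z n) s'+a+1<n)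
           (trans (sym ([m+d]%n≡[m%n+d]%n n z (s' + suc a))) (trans (cong (_% n) (regroup z s' (suc a))) second))
    where
    s'+a+1<n : s' + suc a < n
    s'+a+1<n = s≤s (subst (_≤ a + a) (sym (+-suc s' a)) (+-monoˡ-≤ a s'<a))
    regroup : ∀ z s' b → z + (s' + b) ≡ s' + (z + b)
    regroup = solve-∀
  ... | _ | inj₁ q = 0≢1+n (sym (trans (sym (+-suc (z % n + s') a)) (trans (+-assoc (z % n) s' (suc a)) q)))
  ... | inj₁ q | inj₂ q' = <⇒≢ s'<a (+-cancelʳ-≡ (suc a) s' a
          (trans (trans (sym (cong (_+ (s' + suc a)) (m+n≡0⇒m≡0 (z % n) q))) q') (sym (+-suc a a))))
  ... | inj₂ q | inj₂ q' = <⇒≱ s<a (≤-trans (≤-trans (n≤1+n a) (m≤n+m (suc a) s'))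
          (≤-reflexive (+-cancelˡ-≡ (z % n) (s' + suc a) s (trans q' (sym q)))))

  windowCode : WindowCode (suc a)
  windowCode = record
    { code = λ x → oddCode a (x % n) ; code<k = code<a+1
    ; code-C₂ = λ p → ⊥-elim (0≢1+n (trans (sym p) (+-suc a' a'))) ; code-window = oddCode-window a ≤-refl }
    where
    code<a+1 : ∀ x → oddCode a (x % n) < suc a
    code<a+1 x with x % n
    ... | zero  = ≤-refl
    ... | suc r = m<n⇒m<1+n (oddCode<a a r)

  -- A short arc of the odd cycle either changes parity or avoids the special colour a:
  -- parity only fails to change across the closing edge (from 2a to 0), whose code is not a,
  -- and the step after it (0 to 1) changes parity.
  flipOrAvoid : FlipOrAvoid (λ x → oddCode a (x % n)) a
  flipOrAvoid z zero    _ = inj₂ (λ s ())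
  flipOrAvoid z (suc t) _ with suc (z % n) <? n
  ... | yes below = inj₁ (0 , s≤s z≤n , parity-flips z below)
  ... | no top    = at-top t
    where
    at-top : ∀ t → (Σ ℕ λ s → s < suc t × isEven ((s + z) % n) ≢ isEven ((suc s + z) % n))
                 ⊎ (∀ s → s < suc t → oddCode a ((s + z) % n % n) ≢ a)
    at-top zero    = inj₂ λ { zero _ eq → oddCode≢S a ≤-refl (a' + suc a')
                                 (trans (cong (oddCode a) (sym (trans (m%n%n≡m%n z n) (%-at-top z top)))) eq)
                            ; (suc s) (s≤s ()) }
    at-top (suc t) = inj₁ (1 , s≤s (s≤s z≤n) , λ eq → not≢ true (sym (begin
      true                   ≡⟨ cong isEven (wraps-to-0 z top) ⟨
      isEven ((1 + z) % n)   ≡⟨ eq ⟩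
      isEven ((2 + z) % n)   ≡⟨ cong isEven (trans (suc-% (suc z)) (cong (λ w → suc w % n) (wraps-to-0 z top))) ⟩
      isEven (1 % n)         ≡⟨ cong isEven (m<n⇒m%n≡m (s≤s (s≤s (z≤n {a' + suc a'})))) ⟩
      false                  ∎)))
      where open ≡-Reasoning

Unique-splice : ∀ {A : Set} (X O Y : List A) → Unique (X ++ Y) → Unique O →
  (∀ {c} → c ∈ O → c ∈ X ++ Y → ⊥) → Unique (X ++ O ++ Y)
Unique-splice []      O Y unique-Y unique-O disjoint = Unique.++⁺ unique-O unique-Y (λ (p , q) → disjoint p q)
Unique-splice (x ∷ X) O Y (x∉ AllPairs.∷ unique) unique-O disjoint =
  All.tabulate (λ {c} c∈ → x≢ c c∈) AllPairs.∷ Unique-splice X O Y unique unique-O (λ p q → disjoint p (there q))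
  where
  x≢ : ∀ c → c ∈ X ++ O ++ Y → x ≢ c
  x≢ c c∈ with ∈-++⁻ X c∈
  ... | inj₁ c∈X = All.lookup x∉ (∈-++⁺ˡ c∈X)
  ... | inj₂ c∈OY with ∈-++⁻ O c∈OY
  ...   | inj₁ c∈O = λ { refl → disjoint c∈O (here refl) }
  ...   | inj₂ c∈Y = All.lookup x∉ (∈-++⁺ʳ X c∈Y)

takes-both-values : ∀ (x y b : Bool) → x ≢ y → x ≡ b ⊎ y ≡ b
takes-both-values true  true  _     x≢y = ⊥-elim (x≢y refl)
takes-both-values false false _     x≢y = ⊥-elim (x≢y refl)
takes-both-values true  false true  _   = inj₁ refl
takes-both-values true  false false _   = inj₂ refl
takes-both-values false true  true  _   = inj₂ refl
takes-both-values false true  false _   = inj₁ refl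

-- The odd cycle is coloured with the odd
-- code whose special colour is S = a + σ, shared with H; in the rows of odd parity
-- the odd code is rotated by a + 1 edges, which moves the special edge out of any
-- short arc that contains it in an even row.  A rainbow geodesic follows the
-- H-arc and crosses the odd cycle in a row where the special colour cannot clash.
module OddTimesCycle (a' mh : ℕ) {ch : ℕ} (Wh : CycleGeometry.WindowCode mh ch) (σ : ℕ) (σ<ch : σ < ch)
  (h-flipOrAvoid : CycleGeometry.FlipOrAvoid mh (CycleGeometry.WindowCode.code Wh) σ) where

  open OddCycle a' using (a; oddCode; oddCode<a; oddCode-window; special-edge-once)
  module O = CycleGeometry (a' + suc a')
  module H = CycleGeometry mh
  open H.WindowCode Wh renaming (code to Kh; code<k to Kh<ch; code-C₂ to Kh-C₂; code-window to Kh-window)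

  n nh : ℕ
  n  = O.n
  nh = H.n

  GP : Graph
  GP = O.G □ H.G

  S : ℕ
  S = a + σ

  KO : ℕ → ℕ
  KO x = oddCode S (x % n)

  rotation : ℕ → ℕ
  rotation v = if isEven v then 0 else suc a

  κO : ℕ → Labelling O.G ℕ
  κO r e = KO (O.edgeIndex e + r)

  code : Labelling GP ℕ
  code {u} (inj₁ (_ , e)) = κO (rotation (toℕ (proj₂ u))) e
  code     (inj₂ (_ , e)) = a + Kh (H.edgeIndex e)

  code<a+ch : ∀ {u v} (e : Adj GP u v) → code e < a + ch
  code<a+ch (inj₂ (_ , e)) = +-monoʳ-< a (Kh<ch _)
  code<a+ch {u} (inj₁ (_ , e)) with (O.edgeIndex e + rotation (toℕ (proj₂ u))) % n
  ... | zero  = +-monoʳ-< a σ<ch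
  ... | suc r = <-≤-trans (oddCode<a S r) (m≤m+n a ch)

  O-not-C₂ : ∀ {K : ℕ → ℕ} → a' + suc a' ≡ 0 → K 0 ≡ K 1
  O-not-C₂ p = ⊥-elim (0≢1+n (trans (sym p) (+-suc a' a')))

  κO-symmetric : ∀ r {i j} (e : Adj O.G i j) (e' : Adj O.G j i) → κO r e ≡ κO r e'
  κO-symmetric r = O.edgeIndex-symmetric (λ w → KO (w + r)) (O-not-C₂ {λ w → KO (w + r)})

  code-symm : ∀ {u v} (e : Adj GP u v) (e' : Adj GP v u) → code e ≡ code e'
  code-symm {u} (inj₁ (p , e)) (inj₁ (_ , e')) =
    trans (κO-symmetric (rotation (toℕ (proj₂ u))) e e') (cong (λ l → κO (rotation (toℕ l)) e') p)
  code-symm (inj₁ (_ , e)) (inj₂ (p' , _)) = ⊥-elim (Cycle-loopless n (s≤s (s≤s z≤n)) (subst (Adj O.G _) p' e))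
  code-symm (inj₂ (_ , e)) (inj₁ (p' , _)) = ⊥-elim (Cycle-loopless nh (s≤s (s≤s z≤n)) (subst (Adj H.G _) p' e))
  code-symm (inj₂ (_ , e)) (inj₂ (_ , e')) = cong (a +_) (H.edgeIndex-symmetric Kh Kh-C₂ e e')

  c : EdgeColouring GP (a + ch)
  c = record { col  = λ e → fromℕ< (code<a+ch e)
             ; symm = λ e e' → toℕ-injective (trans (toℕ-fromℕ< (code<a+ch e))
                                 (trans (code-symm e e') (sym (toℕ-fromℕ< (code<a+ch e'))))) }

  codes : ∀ {u v} (w : Walk GP u v) → map toℕ (walkColours c w) ≡ edgeLabels code w
  codes w = trans (cong (map toℕ) (walkColours≡edgeLabels c w))
              (trans (map-edgeLabels toℕ (col c) w) (edgeLabels-cong (λ e → toℕ-fromℕ< (code<a+ch e)) w))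

  oddWindow : ℕ → ℕ → List ℕ
  oddWindow z t = applyUpTo (λ s → oddCode S ((s + z) % n)) t

  hWindow : ℕ → ℕ → List ℕ
  hWindow z t = applyUpTo (λ s → a + Kh ((s + z) % nh)) t

  oddWindow-unique : ∀ z t → t ≤ a → Unique (oddWindow z t)
  oddWindow-unique z t t≤a = Unique.applyUpTo⁺₁ _ t λ {i} {j} i<j j<t eq →
    oddCode-window S (m≤m+n a σ) z t (≤-trans (+-mono-≤ t≤a t≤a) (n≤1+n (a + a))) i<j j<t
      (trans (cong (oddCode S) (m%n%n≡m%n (i + z) n)) (trans eq (cong (oddCode S) (sym (m%n%n≡m%n (j + z) n)))))

  hWindow-unique : ∀ z t → t + t ≤ nh → Unique (hWindow z t)
  hWindow-unique z t short = Unique.applyUpTo⁺₁ _ t λ i<j j<t eq → Kh-window z t short i<j j<t (+-cancelˡ-≡ a _ _ eq)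

  hWindow-split : ∀ z sp t → sp ≤ t → hWindow z sp ++ hWindow (sp + z) (t ∸ sp) ≡ hWindow z t
  hWindow-split z sp t sp≤t = begin
    hWindow z sp ++ hWindow (sp + z) (t ∸ sp)
      ≡⟨ cong (hWindow z sp ++_) (applyUpTo-cong (λ s → cong (λ w → a + Kh (w % nh)) (regroup s)) (t ∸ sp)) ⟩
    hWindow z sp ++ applyUpTo (λ s → a + Kh (((sp + s) + z) % nh)) (t ∸ sp)
      ≡⟨ applyUpTo-+ _ sp (t ∸ sp) ⟨
    hWindow z (sp + (t ∸ sp))
      ≡⟨ cong (hWindow z) (m+[n∸m]≡n sp≤t) ⟩
    hWindow z t ∎
    where
    open ≡-Reasoning
    regroup : ∀ s → s + (sp + z) ≡ (sp + s) + z
    regroup s = trans (sym (+-assoc s sp z)) (cong (_+ z) (+-comm s sp))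

  edgeLabels-κO-arc : ∀ r z t → edgeLabels (κO r) (O.arc z t) ≡ oddWindow (z + r) t
  edgeLabels-κO-arc r z t = trans (O.edgeLabels-arc (κO r) (λ w → KO (w + r)) (λ e → refl) z t)
    (applyUpTo-cong (λ s → cong (oddCode S)
      (trans (sym ([m+d]%n≡[m%n+d]%n n (s + z) r)) (cong (_% n) (+-assoc s z r)))) t)

  record OddSegment (x x' : Fin n) : Set where
    field
      start len  : ℕ
      len≤a      : len ≤ a
      walk       : Walk O.G x x'
      geodesic   : Geodesic walk
      unique     : ∀ r → Unique (edgeLabels (κO r) walk)
      within     : ∀ r {c} → c ∈ edgeLabels (κO r) walk → c ∈ oddWindow (start + r) len

  oddSegment : ∀ x x' → OddSegment x x'
  oddSegment x x' with O.shortArc x x'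
  ... | z , t , short , t≤d , inj₁ (p , q) = record
    { start = z ; len = t ; len≤a = t≤a ; walk = w ; geodesic = O.arc-geodesic z t p q t≤d
    ; unique = λ r → subst Unique (sym (labels r)) (oddWindow-unique (z + r) t t≤a)
    ; within = λ r c∈ → subst (_ ∈_) (labels r) c∈ }
    where
    t≤a : t ≤ a
    t≤a = half-≤-odd t a short
    w : Walk O.G x x'
    w = castʷ p q (O.arc z t)
    labels : ∀ r → edgeLabels (κO r) w ≡ oddWindow (z + r) t
    labels r = trans (edgeLabels-castʷ (κO r) p q (O.arc z t)) (edgeLabels-κO-arc r z t)
  ... | z , t , short , t≤d , inj₂ (p , q) = record
    { start = z ; len = t ; len≤a = t≤a ; walk = w ; geodesic = geo
    ; unique = λ r → subst Unique (sym (labels r)) (Unique-reverse _ (oddWindow-unique (z + r) t t≤a))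
    ; within = λ r c∈ → Any.reverse⁻ (subst (_ ∈_) (labels r) c∈) }
    where
    t≤a : t ≤ a
    t≤a = half-≤-odd t a short
    w₀ : Walk O.G x' x
    w₀ = castʷ p q (O.arc z t)
    w : Walk O.G x x'
    w = reverseʷ (Cycle-symmetric n) w₀
    length-w : walkLength w ≡ t
    length-w = trans (length-reverseʷ (Cycle-symmetric n) w₀) (trans (length-castʷ p q (O.arc z t)) (O.length-arc z t))
    geo : Geodesic w
    geo = geodesic-of-length w length-w (λ w' → ≤-trans t≤d (O.distance≤length w'))
    labels : ∀ r → edgeLabels (κO r) w ≡ reverse (oddWindow (z + r) t)
    labels r = trans (edgeLabels-reverseʷ (Cycle-symmetric n) (κO r) (λ e → κO-symmetric r (Cycle-symmetric n e) e) w₀)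
                 (cong reverse (trans (edgeLabels-castʷ (κO r) p q (O.arc z t)) (edgeLabels-κO-arc r z t)))

  rotation-even : ∀ v → isEven v ≡ true → rotation v ≡ 0
  rotation-even v p = cong (if_then 0 else suc a) p

  rotation-odd : ∀ v → isEven v ≡ false → rotation v ≡ suc a
  rotation-odd v p = cong (if_then 0 else suc a) p

  -- Row sp is crossable for the odd window (zo, to) and the H-arc (zh, th) if, with the
  -- rotation of that row, the odd window misses the special edge 0, or the H-arc never
  -- uses the colour a + σ = S.
  Crossable : ℕ → ℕ → ℕ → ℕ → ℕ → Set
  Crossable zh th zo to sp = (∀ s → s < to → (s + (zo + rotation ((sp + zh) % nh))) % n ≢ 0)
                           ⊎ (∀ s → s < th → Kh ((s + zh) % nh) ≢ σ)

  special-in-window? : ∀ z t → (Σ ℕ λ s → s < t × (s + z) % n ≡ 0) ⊎ (∀ s → s < t → (s + z) % n ≢ 0)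
  special-in-window? z t with any? {n = t} (λ i → (toℕ i + z) % n ≟ 0)
  ... | yes (i , hit) = inj₁ (toℕ i , toℕ<n i , hit)
  ... | no none       = inj₂ λ s s<t hit → none (fromℕ< s<t , subst (λ w → (w + z) % n ≡ 0) (sym (toℕ-fromℕ< s<t)) hit)

  row-of-parity : ∀ zh th s → s < th → isEven ((s + zh) % nh) ≢ isEven ((suc s + zh) % nh) →
    ∀ b → Σ ℕ λ sp → sp ≤ th × isEven ((sp + zh) % nh) ≡ b
  row-of-parity zh th s s<th flips b with takes-both-values _ _ b flips
  ... | inj₁ p = s , <⇒≤ s<th , p
  ... | inj₂ p = suc s , s<th , p

  -- A crossable row exists along every short H-arc: if the arc does not avoid σ, its
  -- parity changes, so rows of both parities are available; an even row (no rotation)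
  -- works when the odd window misses edge 0, and otherwise an odd row (rotation a + 1) does.
  crossing-row : ∀ zh th zo to → th + th ≤ nh → to ≤ a → Σ ℕ λ sp → sp ≤ th × Crossable zh th zo to sp
  crossing-row zh th zo to short to≤a with h-flipOrAvoid zh th short
  ... | inj₂ avoids            = 0 , z≤n , inj₂ avoids
  ... | inj₁ (s , s<th , flips) with special-in-window? zo to
  ...   | inj₂ misses with row-of-parity zh th s s<th flips true
  ...     | sp , sp≤th , even = sp , sp≤th , inj₁ λ s' s'<to hit →
              misses s' s'<to (subst (λ r → (s' + r) % n ≡ 0)
                (trans (cong (zo +_) (rotation-even ((sp + zh) % nh) even)) (+-identityʳ zo)) hit)
  crossing-row zh th zo to short to≤a | inj₁ (s , s<th , flips) | inj₁ (s₁ , s₁<to , hit₁)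
    with row-of-parity zh th s s<th flips false
  ... | sp , sp≤th , odd = sp , sp≤th , inj₁ λ s' s'<to hit →
          special-edge-once zo s₁ s' (<-≤-trans s₁<to to≤a) (<-≤-trans s'<to to≤a) hit₁
            (subst (λ r → (s' + (zo + r)) % n ≡ 0) (rotation-odd ((sp + zh) % nh) odd) hit)

  detour : ∀ {x x'} (ow : Walk O.G x x') zh sp t → Walk GP (x , H.vertex zh) (x' , H.vertex (t + (sp + zh)))
  detour {x} {x'} ow zh sp t =
    liftʳ {O.G} {H.G} x (H.arc zh sp) ++ʷ (liftˡ {O.G} {H.G} (H.vertex (sp + zh)) ow ++ʷ liftʳ {O.G} {H.G} x' (H.arc (sp + zh) t))

  length-detour : ∀ {x x'} (ow : Walk O.G x x') zh sp t → walkLength (detour ow zh sp t) ≡ walkLength ow + (sp + t)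
  length-detour {x} {x'} ow zh sp t = begin
    walkLength (detour ow zh sp t)
      ≡⟨ length-++ʷ (liftʳ {O.G} {H.G} x (H.arc zh sp)) _ ⟩
    walkLength (liftʳ {O.G} {H.G} x (H.arc zh sp)) + walkLength (liftˡ {O.G} {H.G} l ow ++ʷ liftʳ {O.G} {H.G} x' (H.arc (sp + zh) t))
      ≡⟨ cong₂ _+_ (trans (length-liftʳ x (H.arc zh sp)) (H.length-arc zh sp))
           (trans (length-++ʷ (liftˡ {O.G} {H.G} l ow) _)
             (cong₂ _+_ (length-liftˡ l ow) (trans (length-liftʳ x' (H.arc (sp + zh) t)) (H.length-arc (sp + zh) t)))) ⟩
    sp + (walkLength ow + t)
      ≡⟨ +-assoc sp (walkLength ow) t ⟨
    (sp + walkLength ow) + t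
      ≡⟨ cong (_+ t) (+-comm sp (walkLength ow)) ⟩
    (walkLength ow + sp) + t
      ≡⟨ +-assoc (walkLength ow) sp t ⟩
    walkLength ow + (sp + t) ∎
    where
    open ≡-Reasoning
    l : Fin nh
    l = H.vertex (sp + zh)

  edgeLabels-detour : ∀ {x x'} (ow : Walk O.G x x') zh sp t → edgeLabels code (detour ow zh sp t) ≡
    hWindow zh sp ++ (edgeLabels (κO (rotation ((sp + zh) % nh))) ow ++ hWindow (sp + zh) t)
  edgeLabels-detour {x} {x'} ow zh sp t = begin
    edgeLabels code (detour ow zh sp t)
      ≡⟨ edgeLabels-++ʷ code (liftʳ {O.G} {H.G} x (H.arc zh sp)) _ ⟩
    edgeLabels code (liftʳ {O.G} {H.G} x (H.arc zh sp))
      ++ edgeLabels code (liftˡ {O.G} {H.G} l ow ++ʷ liftʳ {O.G} {H.G} x' (H.arc (sp + zh) t))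
      ≡⟨ cong₂ _++_ (hArc x zh sp) (trans (edgeLabels-++ʷ code (liftˡ {O.G} {H.G} l ow) _)
                                        (cong₂ _++_ oddPart (hArc x' (sp + zh) t))) ⟩
    hWindow zh sp ++ (edgeLabels (κO (rotation ((sp + zh) % nh))) ow ++ hWindow (sp + zh) t) ∎
    where
    open ≡-Reasoning
    l : Fin nh
    l = H.vertex (sp + zh)
    hArc : ∀ x z t → edgeLabels code (liftʳ {O.G} {H.G} x (H.arc z t)) ≡ hWindow z t
    hArc x z t = trans (edgeLabels-liftʳ code x (H.arc z t)) (H.edgeLabels-arc _ (λ w → a + Kh w) (λ e → refl) z t)
    oddPart : edgeLabels code (liftˡ {O.G} {H.G} l ow) ≡ edgeLabels (κO (rotation ((sp + zh) % nh))) ow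
    oddPart = trans (edgeLabels-liftˡ code l ow) (cong (λ v → edgeLabels (κO (rotation v)) ow) (H.toℕ-vertex (sp + zh)))

  -- In a crossable row the odd segment and the H-arc use disjoint colours: odd codes
  -- are below a except S, H codes are at least a, and S = a + σ cannot meet both.
  crossing-disjoint : ∀ {x x'} (seg : OddSegment x x') zh th sp →
    Crossable zh th (OddSegment.start seg) (OddSegment.len seg) sp →
    ∀ {c} → c ∈ edgeLabels (κO (rotation ((sp + zh) % nh))) (OddSegment.walk seg) → c ∈ hWindow zh th → ⊥
  crossing-disjoint seg zh th sp crossable {c} c∈odd c∈h =
    let (s₁ , s₁<len , c≡odd) = ∈-applyUpTo⁻ (λ s → oddCode S ((s + (start + r)) % n)) (within r c∈odd)
        (s₂ , s₂<th , c≡h)    = ∈-applyUpTo⁻ (λ s → a + Kh ((s + zh) % nh)) c∈h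
    in clash s₁<len s₂<th c≡h _ refl c≡odd
    where
    open OddSegment seg
    r : ℕ
    r = rotation ((sp + zh) % nh)
    clash : ∀ {s₁ s₂} → s₁ < len → s₂ < th → c ≡ a + Kh ((s₂ + zh) % nh) →
      ∀ v → v ≡ (s₁ + (start + r)) % n → c ≡ oddCode S v → ⊥
    clash {s₁} {s₂} s₁<len s₂<th c≡h zero v≡ c≡S =
      [ (λ misses → misses s₁ s₁<len (sym v≡))
      , (λ avoids → avoids s₂ s₂<th (+-cancelˡ-≡ a _ _ (trans (sym c≡h) c≡S))) ]′ crossable
    clash _ _ c≡h (suc q) _ c≡q = <⇒≱ (subst (_< a) (sym c≡q) (oddCode<a S q)) (subst (a ≤_) (sym c≡h) (m≤m+n a _))

  rainbow-detour : ∀ x x' {y y'} zh th → th + th ≤ nh → th ≤ H.distance (toℕ y) (toℕ y') →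
    (p : H.vertex zh ≡ y) (q : H.vertex (th + zh) ≡ y') (seg : OddSegment x x') →
    ∀ sp → sp ≤ th → Crossable zh th (OddSegment.start seg) (OddSegment.len seg) sp →
    RainbowGeodesic c (x , y) (x' , y')
  rainbow-detour x x' {y} {y'} zh th short th≤d p q seg sp sp≤th crossable =
    W , product-geodesic walk hw geodesic (H.arc-geodesic zh th p q th≤d) W length-W ,
    Unique.map⁻ (subst Unique (sym colours)
      (Unique-splice H₁ O' H₂ (subst Unique (sym (hWindow-split zh sp th sp≤th)) (hWindow-unique zh th short))
        (unique r) (λ c∈O c∈H → crossing-disjoint seg zh th sp crossable c∈O
                                   (subst (_ ∈_) (hWindow-split zh sp th sp≤th) c∈H))))
    where
    open OddSegment seg
    r : ℕ
    r = rotation ((sp + zh) % nh)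
    H₁ O' H₂ : List ℕ
    H₁ = hWindow zh sp
    O' = edgeLabels (κO r) walk
    H₂ = hWindow (sp + zh) (th ∸ sp)
    ends : H.vertex ((th ∸ sp) + (sp + zh)) ≡ y'
    ends = trans (cong H.vertex (trans (sym (+-assoc (th ∸ sp) sp zh)) (cong (_+ zh) (m∸n+n≡m sp≤th)))) q
    W : Walk GP (x , y) (x' , y')
    W = castʷ (cong (x ,_) p) (cong (x' ,_) ends) (detour walk zh sp (th ∸ sp))
    hw : Walk H.G y y'
    hw = castʷ p q (H.arc zh th)
    length-W : walkLength W ≡ walkLength walk + walkLength hw
    length-W = begin
      walkLength W                              ≡⟨ length-castʷ _ _ (detour walk zh sp (th ∸ sp)) ⟩
      walkLength (detour walk zh sp (th ∸ sp))  ≡⟨ length-detour walk zh sp (th ∸ sp) ⟩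
      walkLength walk + (sp + (th ∸ sp))        ≡⟨ cong (walkLength walk +_) (m+[n∸m]≡n sp≤th) ⟩
      walkLength walk + th
        ≡⟨ cong (walkLength walk +_) (trans (length-castʷ p q (H.arc zh th)) (H.length-arc zh th)) ⟨
      walkLength walk + walkLength hw           ∎
      where open ≡-Reasoning
    colours : map toℕ (walkColours c W) ≡ H₁ ++ O' ++ H₂
    colours = trans (codes W) (trans (edgeLabels-castʷ code _ _ (detour walk zh sp (th ∸ sp)))
                                     (edgeLabels-detour walk zh sp (th ∸ sp)))

  rainbow-along : ∀ x x' {y y'} zh th → th + th ≤ nh → th ≤ H.distance (toℕ y) (toℕ y') →
    H.vertex zh ≡ y → H.vertex (th + zh) ≡ y' → RainbowGeodesic c (x , y) (x' , y')
  rainbow-along x x' zh th short th≤d p q with oddSegment x x'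
  ... | seg with crossing-row zh th (OddSegment.start seg) (OddSegment.len seg) short (OddSegment.len≤a seg)
  ...   | sp , sp≤th , crossable = rainbow-detour x x' zh th short th≤d p q seg sp sp≤th crossable

  rainbow : StronglyRainbow c
  rainbow (x , y) (x' , y') with H.shortArc y y'
  ... | zh , th , short , th≤d , inj₁ (p , q) = rainbow-along x x' zh th short th≤d p q
  ... | zh , th , short , th≤d , inj₂ (p , q) =
    rainbowGeodesic-sym {GP} (□-symmetric {O.G} {H.G} (Cycle-symmetric n) (Cycle-symmetric nh)) c {x , y} {x' , y'}
      (rainbow-along x' x {y'} {y} zh th short (subst (th ≤_) (H.distance-sym (toℕ y) (toℕ y')) th≤d) p q)

  Src-odd□cycle : Src GP (a + ch)
  Src-odd□cycle = a + ch , ≤-refl , c , rainbow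

-- The building blocks, for a = a' + 1 and b = b' + 1:
-- src(C_{2b}) ≤ b, src(C_{2a+1}) ≤ a + 1, src(C_{2a+1} □ C_{2b}) ≤ a + b and
-- src(C_{2a+1} □ C_{2b+1}) ≤ a + b + 1.
Src-even : ∀ m b' → suc (suc m) ≡ suc b' + suc b' → Src (Cycle (suc (suc m))) (suc b')
Src-even m b' n≡2b = CycleGeometry.Src-cycle m (EvenCycle.windowCode m b' n≡2b)

Src-odd : ∀ a' → Src (Cycle (suc (suc a' + suc a'))) (suc (suc a'))
Src-odd a' = CycleGeometry.Src-cycle (a' + suc a') (OddCycle.windowCode a')

Src-odd□even : ∀ a' m b' → suc (suc m) ≡ suc b' + suc b' →
  Src (Cycle (suc (suc a' + suc a')) □ Cycle (suc (suc m))) (suc a' + suc b')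
Src-odd□even a' m b' n≡2b =
  OddTimesCycle.Src-odd□cycle a' m (EvenCycle.windowCode m b' n≡2b) 0 (s≤s z≤n) (EvenCycle.flipOrAvoid m b' n≡2b)

Src-odd□odd : ∀ a' b' → Src (Cycle (suc (suc a' + suc a')) □ Cycle (suc (suc b' + suc b'))) (suc a' + suc (suc b'))
Src-odd□odd a' b' =
  OddTimesCycle.Src-odd□cycle a' (b' + suc b') (OddCycle.windowCode b') (suc b') ≤-refl (OddCycle.flipOrAvoid b')

2b≡b+b : ∀ b' → suc (suc (b' + b')) ≡ suc b' + suc b'
2b≡b+b b' = cong suc (sym (+-suc b' b'))

Parity : ℕ → Set
Parity n = (Σ ℕ λ a' → n ≡ suc (suc a' + suc a')) ⊎ (Σ ℕ λ b' → n ≡ suc (suc (b' + b')))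

parity : ∀ n → 2 ≤ n → Parity n
parity (suc zero) (s≤s ())
parity (suc (suc zero)) _ = inj₂ (0 , refl)
parity (suc (suc (suc zero))) _ = inj₁ (0 , refl)
parity (suc (suc (suc (suc k)))) _ with parity (suc (suc k)) (s≤s (s≤s z≤n))
... | inj₁ (a' , e) = inj₁ (suc a' , cong (λ w → suc (suc w)) (trans e (cong suc (sym (+-suc a' (suc a'))))))
... | inj₂ (b' , e) = inj₂ (suc b' , cong (λ w → suc (suc w)) (trans e (2b≡b+b b')))

isEven-2a+1 : ∀ a' → isEven (suc (suc a' + suc a')) ≡ false
isEven-2a+1 a' = trans (isEven-suc (suc a' + suc a')) (cong not (isEven-double (suc a')))

⌊2a+1/2⌋ : ∀ a' → ⌊ suc (suc a' + suc a') /2⌋ ≡ suc a'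
⌊2a+1/2⌋ a' = sym (n≡⌈n+n/2⌉ (suc a'))

⌊2b/2⌋ : ∀ b' → ⌊ suc (suc (b' + b')) /2⌋ ≡ suc b'
⌊2b/2⌋ b' = cong suc (sym (n≡⌊n+n/2⌋ b'))

Π : List ℕ → Graph
Π []       = K₁
Π (x ∷ xs) = Cycle x □ Π xs

Π-symmetric : ∀ xs → Symmetric (Π xs)
Π-symmetric []       ()
Π-symmetric (x ∷ xs) = □-symmetric {Cycle x} {Π xs} (Cycle-symmetric x) (Π-symmetric xs)

Π-loopless : ∀ xs → All.All (2 ≤_) xs → Loopless (Π xs)
Π-loopless []       _                  ()
Π-loopless (x ∷ xs) (2≤x All.∷ 2≤xs) = □-loopless {Cycle x} {Π xs} (Cycle-loopless x 2≤x) (Π-loopless xs 2≤xs)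

total : (ℕ → ℕ) → List ℕ → ℕ
total f []       = 0
total f (x ∷ xs) = f x + total f xs

oddOne evenOne : ℕ → ℕ
oddOne  x = if isEven x then 0 else 1
evenOne x = if isEven x then 1 else 0

pairingBound : List ℕ → ℕ
pairingBound xs = total ⌊_/2⌋ xs + ⌈ total oddOne xs ∸ total evenOne xs /2⌉

length≡total : ∀ xs → length xs ≡ total (λ _ → 1) xs
length≡total []       = refl
length≡total (x ∷ xs) = cong suc (length≡total xs)

-- Bringing the first factor with property Q to the front: Π xs ≅ C_y □ Π ys and the
-- multiset xs is y followed by ys (as seen by every sum).
Extracted : (ℕ → Bool) → List ℕ → Set
Extracted Q xs = Σ ℕ λ y → Σ (List ℕ) λ ys → Q y ≡ true × 2 ≤ y × All.All (2 ≤_) ys ×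
  (Π xs ≅ (Cycle y □ Π ys)) × (∀ f → total f xs ≡ f y + total f ys)

extract : ∀ (Q : ℕ → Bool) xs → All.All (2 ≤_) xs → Extracted Q xs ⊎ All.All (λ x → Q x ≡ false) xs
extract Q []       _ = inj₂ All.[]
extract Q (x ∷ xs) (2≤x All.∷ 2≤xs) with Q x in Qx
... | true  = inj₁ (x , xs , Qx , 2≤x , 2≤xs , ≅-refl , λ f → refl)
... | false with extract Q xs 2≤xs
...   | inj₂ none = inj₂ (Qx All.∷ none)
...   | inj₁ (y , ys , Qy , 2≤y , 2≤ys , iso , totals) =
  inj₁ (y , x ∷ ys , Qy , 2≤y , 2≤x All.∷ 2≤ys , ≅-trans (□-congʳ {Cycle x} iso) (□-leftComm {Cycle x} {Cycle y} {Π ys}) ,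
        λ f → trans (cong (f x +_) (totals f)) (exchange (f x) (f y) (total f ys)))
  where
  exchange : ∀ p q r → p + (q + r) ≡ q + (p + r)
  exchange = solve-∀

Src-split : ∀ {G Γ ys b₁ b₂} → G ≅ (Γ □ Π ys) → Symmetric Γ → Loopless Γ → All.All (2 ≤_) ys →
  Src Γ b₁ → Src (Π ys) b₂ → Src G (b₁ + b₂)
Src-split {Γ = Γ} {ys} iso sΓ ℓΓ 2≤ys src₁ src₂ =
  Src-≅ iso (□-symmetric {Γ} {Π ys} sΓ (Π-symmetric ys)) (Src-□ ℓΓ (Π-loopless ys 2≤ys) src₁ src₂)

two-cycles-symmetric : ∀ x y → Symmetric (Cycle x □ Cycle y)
two-cycles-symmetric x y = □-symmetric {Cycle x} {Cycle y} (Cycle-symmetric x) (Cycle-symmetric y)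

two-cycles-loopless : ∀ {x y} → 2 ≤ x → 2 ≤ y → Loopless (Cycle x □ Cycle y)
two-cycles-loopless {x} {y} 2≤x 2≤y = □-loopless {Cycle x} {Cycle y} (Cycle-loopless x 2≤x) (Cycle-loopless y 2≤y)

Bounded : List ℕ → Set
Bounded xs = Src (Π xs) (pairingBound xs)

BoundedShorter : List ℕ → Set
BoundedShorter xs = ∀ ys → length ys < length xs → All.All (2 ≤_) ys → Bounded ys

shorter : ∀ xs {y} ys → (∀ f → total f xs ≡ f y + total f ys) → length ys < suc (length xs)
shorter xs ys totals = subst (_≤ suc (length xs)) length-xs (n≤1+n (length xs))
  where
  length-xs : length xs ≡ suc (length ys)
  length-xs = trans (length≡total xs) (trans (totals (λ _ → 1)) (cong suc (sym (length≡total ys))))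

no-evens : ∀ zs → All.All (λ z → isEven z ≡ false) zs → total evenOne zs ≡ 0
no-evens []       _                  = refl
no-evens (z ∷ zs) (odd-z All.∷ odds) rewrite odd-z = no-evens zs odds

no-odds : ∀ zs → All.All (λ z → not (isEven z) ≡ false) zs → total oddOne zs ≡ 0
no-odds []       _ = refl
no-odds (z ∷ zs) (even-z All.∷ evens) with isEven z
no-odds (z ∷ zs) (() All.∷ evens) | false
... | true = no-odds zs evens

OddHalf EvenHalf : ℕ → ℕ → Set
OddHalf  x a = ⌊ x /2⌋ ≡ a × isEven x ≡ false
EvenHalf x b = ⌊ x /2⌋ ≡ b × isEven x ≡ true

oddHalf : ∀ a' → OddHalf (suc (suc a' + suc a')) (suc a')
oddHalf a' = ⌊2a+1/2⌋ a' , isEven-2a+1 a'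

evenHalf : ∀ b' → EvenHalf (suc (suc (b' + b'))) (suc b')
evenHalf b' = ⌊2b/2⌋ b' , isEven-double b'

bound-odd-even : ∀ {x y a b} xs ys → OddHalf x a → EvenHalf y b → (∀ f → total f xs ≡ f y + total f ys) →
  (a + b) + pairingBound ys ≡ pairingBound (x ∷ xs)
bound-odd-even {a = a} {b} xs ys (hx , ex) (hy , ey) totals
  rewrite totals ⌊_/2⌋ | totals oddOne | totals evenOne | hx | ex | hy | ey = regroup a b (total ⌊_/2⌋ ys) _
  where
  regroup : ∀ A B S t → (A + B) + (S + t) ≡ (A + (B + S)) + t
  regroup = solve-∀

bound-even-odd : ∀ {x y a b} xs ys → EvenHalf x b → OddHalf y a → (∀ f → total f xs ≡ f y + total f ys) →
  (a + b) + pairingBound ys ≡ pairingBound (x ∷ xs)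
bound-even-odd {a = a} {b} xs ys (hx , ex) (hy , ey) totals
  rewrite totals ⌊_/2⌋ | totals oddOne | totals evenOne | hx | ex | hy | ey = regroup a b (total ⌊_/2⌋ ys) _
  where
  regroup : ∀ A B S t → (A + B) + (S + t) ≡ (B + (A + S)) + t
  regroup = solve-∀

bound-odd-odd : ∀ {x y a b} zs → OddHalf x a → OddHalf y b → total evenOne zs ≡ 0 →
  (a + suc b) + pairingBound zs ≡ pairingBound (x ∷ y ∷ zs)
bound-odd-odd {a = a} {b} zs (hx , ex) (hy , ey) no-even rewrite no-even | hx | ex | hy | ey =
  regroup a b (total ⌊_/2⌋ zs) ⌈ total oddOne zs /2⌉
  where
  regroup : ∀ A B S t → (A + suc B) + (S + t) ≡ (A + (B + S)) + suc t
  regroup = solve-∀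

bound-odd : ∀ {x a} → OddHalf x a → suc a + 0 ≡ pairingBound (x ∷ [])
bound-odd {a = a} (hx , ex) rewrite hx | ex = regroup a
  where
  regroup : ∀ A → suc A + 0 ≡ (A + 0) + 1
  regroup = solve-∀

bound-even : ∀ {x b} xs → EvenHalf x b → total oddOne xs ≡ 0 → b + pairingBound xs ≡ pairingBound (x ∷ xs)
bound-even {b = b} xs (hx , ex) no-odd rewrite no-odd | hx | ex | 0∸n≡0 (total evenOne xs) =
  regroup b (total ⌊_/2⌋ xs)
  where
  regroup : ∀ B S → B + (S + 0) ≡ (B + S) + 0
  regroup = solve-∀

false≢true : false ≢ true
false≢true ()

-- An odd first factor C_{2a+1} is paired with the first even factor if there is one,
-- otherwise with the next (odd) factor, or it stays alone if it is the last one.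
odd-first : ∀ a' xs → All.All (2 ≤_) xs →
  BoundedShorter (suc (suc a' + suc a') ∷ xs) → Bounded (suc (suc a' + suc a') ∷ xs)
odd-first a' [] _ _ = subst (Src _) (bound-odd (oddHalf a'))
  (Src-split ≅-refl (Cycle-symmetric _) (Cycle-loopless _ (s≤s (s≤s z≤n))) All.[] (Src-odd a') Src-K₁)
odd-first a' (y ∷ zs) (2≤y All.∷ 2≤zs) smaller with extract isEven (y ∷ zs) (2≤y All.∷ 2≤zs)
... | inj₁ (y' , ys , even-y' , 2≤y' , 2≤ys , iso , totals) with parity y' 2≤y'
...   | inj₁ (c' , refl) = ⊥-elim (false≢true (trans (sym (isEven-2a+1 c')) even-y'))
...   | inj₂ (b' , refl) = subst (Src _) (bound-odd-even (y ∷ zs) ys (oddHalf a') (evenHalf b') totals)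
        (Src-split (≅-trans (□-congʳ iso) □-assoc) (two-cycles-symmetric _ _) (two-cycles-loopless (s≤s (s≤s z≤n)) 2≤y')
          2≤ys (Src-odd□even a' (b' + b') b' (2b≡b+b b')) (smaller ys (shorter (y ∷ zs) ys totals) 2≤ys))
odd-first a' (y ∷ zs) (2≤y All.∷ 2≤zs) smaller | inj₂ (odd-y All.∷ odd-zs) with parity y 2≤y
... | inj₂ (c' , refl) = ⊥-elim (false≢true (trans (sym odd-y) (isEven-double c')))
... | inj₁ (b' , refl) = subst (Src _) (bound-odd-odd zs (oddHalf a') (oddHalf b') (no-evens zs odd-zs))
        (Src-split □-assoc (two-cycles-symmetric _ _) (two-cycles-loopless (s≤s (s≤s z≤n)) 2≤y)
          2≤zs (Src-odd□odd a' b') (smaller zs (s≤s (n≤1+n (length zs))) 2≤zs))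

-- An even first factor C_{2b} is paired with the first odd factor if there is one,
-- otherwise it stays alone.
even-first : ∀ b' xs → All.All (2 ≤_) xs →
  BoundedShorter (suc (suc (b' + b')) ∷ xs) → Bounded (suc (suc (b' + b')) ∷ xs)
even-first b' xs 2≤xs smaller with extract (λ z → not (isEven z)) xs 2≤xs
... | inj₁ (y , ys , odd-y , 2≤y , 2≤ys , iso , totals) with parity y 2≤y
...   | inj₂ (c' , refl) = ⊥-elim (false≢true (trans (sym (cong not (isEven-double c'))) odd-y))
...   | inj₁ (a' , refl) = subst (Src _) (bound-even-odd xs ys (evenHalf b') (oddHalf a') totals)
        (Src-split (≅-trans (□-congʳ iso) (≅-trans □-leftComm □-assoc)) (two-cycles-symmetric _ _)
          (two-cycles-loopless 2≤y (s≤s (s≤s z≤n))) 2≤ys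
          (Src-odd□even a' (b' + b') b' (2b≡b+b b')) (smaller ys (shorter xs ys totals) 2≤ys))
even-first b' xs 2≤xs smaller | inj₂ all-even = subst (Src _) (bound-even xs (evenHalf b') (no-odds xs all-even))
        (Src-split ≅-refl (Cycle-symmetric _) (Cycle-loopless _ (s≤s (s≤s z≤n))) 2≤xs
          (Src-even (b' + b') b' (2b≡b+b b')) (smaller xs ≤-refl 2≤xs))

Src-Π : ∀ xs → All.All (2 ≤_) xs → Bounded xs
Src-Π xs = go (length xs) xs ≤-refl
  where
  go : ∀ k xs → length xs ≤ k → All.All (2 ≤_) xs → Bounded xs
  go k       []       _ _ = Src-K₁
  go (suc k) (x ∷ xs) (s≤s len) (2≤x All.∷ 2≤xs) with parity x 2≤x
  ... | inj₁ (a' , refl) = odd-first a' xs 2≤xs (λ ys shorter → go k ys (≤-pred (≤-trans shorter (s≤s len))))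
  ... | inj₂ (b' , refl) = even-first b' xs 2≤xs (λ ys shorter → go k ys (≤-pred (≤-trans shorter (s≤s len))))

cycleProduct≅Π : ∀ {r} (ns : Vec ℕ (suc r)) → cycleProduct ns ≅ Π (toList ns)
cycleProduct≅Π (n ∷ [])     = □-unitʳ
cycleProduct≅Π (n ∷ m ∷ ns) = □-congʳ {Cycle n} (cycleProduct≅Π (m ∷ ns))

does-2∣? : ∀ x → does (2 ∣? x) ≡ isEven x
does-2∣? zero          = refl
does-2∣? (suc zero)    = refl
does-2∣? (suc (suc k)) = does-2∣? k

x≡⌊x/2⌋+⌊x/2⌋+oddOne : ∀ x → x ≡ (⌊ x /2⌋ + ⌊ x /2⌋) + oddOne x
x≡⌊x/2⌋+⌊x/2⌋+oddOne zero          = refl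
x≡⌊x/2⌋+⌊x/2⌋+oddOne (suc zero)    = refl
x≡⌊x/2⌋+⌊x/2⌋+oddOne (suc (suc k)) = cong suc (trans (cong suc (x≡⌊x/2⌋+⌊x/2⌋+oddOne k))
  (cong (_+ oddOne k) (sym (+-suc ⌊ k /2⌋ ⌊ k /2⌋))))

evenOne+oddOne : ∀ x → evenOne x + oddOne x ≡ 1
evenOne+oddOne x with isEven x
... | true  = refl
... | false = refl

evenOne≤⌊x/2⌋ : ∀ x → 2 ≤ x → evenOne x ≤ ⌊ x /2⌋
evenOne≤⌊x/2⌋ (suc zero) (s≤s ())
evenOne≤⌊x/2⌋ (suc (suc k)) _ with isEven k
... | true  = s≤s z≤n
... | false = z≤n

sum≡ : ∀ {r} (ns : Vec ℕ r) →
  sum ns ≡ (total ⌊_/2⌋ (toList ns) + total ⌊_/2⌋ (toList ns)) + total oddOne (toList ns)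
sum≡ []       = refl
sum≡ (x ∷ ns) = trans (cong₂ _+_ (x≡⌊x/2⌋+⌊x/2⌋+oddOne x) (sum≡ ns)) (regroup ⌊ x /2⌋ (oddOne x) _ _)
  where
  regroup : ∀ h o S O → ((h + h) + o) + ((S + S) + O) ≡ ((h + S) + (h + S)) + (o + O)
  regroup = solve-∀

evenCount≡ : ∀ {r} (ns : Vec ℕ r) → evenCount ns ≡ total evenOne (toList ns)
evenCount≡ []       = refl
evenCount≡ (x ∷ ns) rewrite does-2∣? x with isEven x
... | true  = cong suc (evenCount≡ ns)
... | false = evenCount≡ ns

length≡ : ∀ {r} (ns : Vec ℕ r) → r ≡ total oddOne (toList ns) + total evenOne (toList ns)
length≡ []       = refl
length≡ (x ∷ ns) = trans (cong suc (length≡ ns)) (sym (trans (regroup (oddOne x) (evenOne x) _ _)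
                     (cong (_+ (total oddOne (toList ns) + total evenOne (toList ns))) (evenOne+oddOne x))))
  where
  regroup : ∀ a b c d → (a + c) + (b + d) ≡ (b + a) + (c + d)
  regroup = solve-∀

evens≤halves : ∀ xs → All.All (2 ≤_) xs → total evenOne xs ≤ total ⌊_/2⌋ xs
evens≤halves []       _                  = z≤n
evens≤halves (x ∷ xs) (2≤x All.∷ 2≤xs) = +-mono-≤ (evenOne≤⌊x/2⌋ x 2≤x) (evens≤halves xs 2≤xs)

⌈2S+w/2⌉ : ∀ S w → ⌈ (S + S) + w /2⌉ ≡ S + ⌈ w /2⌉
⌈2S+w/2⌉ zero    w = refl
⌈2S+w/2⌉ (suc S) w = trans (cong (λ v → ⌈ suc v + w /2⌉) (+-suc S S)) (cong suc (⌈2S+w/2⌉ S w))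

⌊n/2⌋+⌊n/2⌋≤n : ∀ n → ⌊ n /2⌋ + ⌊ n /2⌋ ≤ n
⌊n/2⌋+⌊n/2⌋≤n n = subst (⌊ n /2⌋ + ⌊ n /2⌋ ≤_) (⌊n/2⌋+⌈n/2⌉≡n n) (+-monoʳ-≤ ⌊ n /2⌋ (⌊n/2⌋≤⌈n/2⌉ n))

≤ᵇ-true : ∀ {a b} → a ≤ b → (a ≤ᵇ b) ≡ true
≤ᵇ-true a≤b = Equivalence.to T-≡ (≤⇒≤ᵇ a≤b)

≤ᵇ-false : ∀ {a b} → ¬ a ≤ b → (a ≤ᵇ b) ≡ false
≤ᵇ-false {a} {b} a≰b with a ≤ᵇ b in eq
... | false = refl
... | true  = ⊥-elim (a≰b (≤ᵇ⇒≤ a b (subst T (sym eq) tt)))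

-- With S = Σ⌊nᵢ/2⌋, O odd and E even entries (R = O + E of them,
-- E ≤ S), the entries sum to 2S + O and S + ⌈(O ∸ E)/2⌉ equals the stated bound: if
-- E ≤ ⌊R/2⌋ then E ≤ O and it is ⌈(2S + O − E)/2⌉; otherwise O < E and it is
-- S = ⌈(2S + O − R + E)/2⌉.
bound-arithmetic : ∀ S O E R → R ≡ O + E → E ≤ S →
  S + ⌈ O ∸ E /2⌉ ≤ (if E ≤ᵇ ⌊ R /2⌋ then ⌈ ((S + S) + O) ∸ E /2⌉ else ⌈ ((S + S) + O) ∸ R + E /2⌉)
bound-arithmetic S O E R R≡O+E E≤S with E ≤? ⌊ R /2⌋
... | yes E≤R/2 rewrite ≤ᵇ-true E≤R/2 =
  ≤-reflexive (sym (trans (cong ⌈_/2⌉ (+-∸-assoc (S + S) E≤O)) (⌈2S+w/2⌉ S (O ∸ E))))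
  where
  E≤O : E ≤ O
  E≤O = +-cancelʳ-≤ E E O (subst (E + E ≤_) R≡O+E (≤-trans (+-mono-≤ E≤R/2 E≤R/2) (⌊n/2⌋+⌊n/2⌋≤n R)))
... | no E≰R/2 rewrite ≤ᵇ-false E≰R/2 = ≤-reflexive (begin
  S + ⌈ O ∸ E /2⌉                ≡⟨ cong (λ w → S + ⌈ w /2⌉) (m≤n⇒m∸n≡0 (<⇒≤ O<E)) ⟩
  S + 0                          ≡⟨ +-identityʳ S ⟩
  S                              ≡⟨ n≡⌈n+n/2⌉ S ⟩
  ⌈ S + S /2⌉                    ≡⟨ cong ⌈_/2⌉ rest ⟨
  ⌈ ((S + S) + O) ∸ R + E /2⌉    ∎)
  where
  open ≡-Reasoning
  O<E : O < E
  O<E = ≰⇒> λ E≤O → E≰R/2 (subst (_≤ ⌊ R /2⌋) (sym (n≡⌊n+n/2⌋ E))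
                              (⌊n/2⌋-mono (subst (E + E ≤_) (sym R≡O+E) (+-monoˡ-≤ E E≤O))))
  rest : ((S + S) + O) ∸ R + E ≡ S + S
  rest = begin
    ((S + S) + O) ∸ R + E          ≡⟨ cong (λ w → w ∸ R + E) (+-comm (S + S) O) ⟩
    (O + (S + S)) ∸ R + E          ≡⟨ cong (λ w → (O + (S + S)) ∸ w + E) R≡O+E ⟩
    (O + (S + S)) ∸ (O + E) + E    ≡⟨ cong (_+ E) ([m+n]∸[m+o]≡n∸o O (S + S) E) ⟩
    (S + S) ∸ E + E                ≡⟨ m∸n+n≡m (≤-trans E≤S (m≤m+n S S)) ⟩
    S + S                          ∎

pairingBound≤srcBound : ∀ {r} (ns : Vec ℕ (suc r)) → All (2 ≤_) ns → pairingBound (toList ns) ≤ srcBound ns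
pairingBound≤srcBound {r} ns 2≤ns rewrite evenCount≡ ns | sum≡ ns =
  bound-arithmetic (total ⌊_/2⌋ L) (total oddOne L) (total evenOne L) (suc r) (length≡ ns) (evens≤halves L (toList⁺ 2≤ns))
  where
  L : List ℕ
  L = toList ns

theorem1p3 : ∀ (r : ℕ) (ns : Vec ℕ (suc r)) → All (2 ≤_) ns →
    src≤ (cycleProduct ns) (srcBound ns)
theorem1p3 r ns 2≤ns = Src⇒src≤ (Src-weaken product (pairingBound≤srcBound ns 2≤ns))
  where
  product : Src (cycleProduct ns) (pairingBound (toList ns))
  product = Src-≅ (cycleProduct≅Π ns) (Π-symmetric (toList ns)) (Src-Π (toList ns) (toList⁺ 2≤ns))
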